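{- If a labelled sequent $\mathcal{G};\Gamma\vdash\Delta$ is derivable in the calculus $LS_{PASL}$, then it is derivable in $LS_{PASL}$ without using the $cut$ rule.
   Context: Formulae: $A ::= p \mid \top\mid\bot\mid\neg A\mid A\vee A\mid A\wedge A\mid A\to A\mid \top^*\mid A*A\mid A\mathrel{ -\!\!*}A$, $p$ a propositional variable. Labels are elements of $LVar\cup\{\epsilon\}$, $LVar$ an infinite set of label variables, $\epsilon$ a label constant. A labelled formula is $a:A$; a relational atom is $(a,b\triangleright c)$ for labels $a,b,c$. A sequent $\mathcal{G};\Gamma\vdash\Delta$ consists of a set $\mathcal{G}$ of relational atoms and multisets $\Gamma,\Delta$ of labelled formulae; commas denote union. For a label variable $x$ and label $y$, $\mathcal{G}[y/x],\Gamma[y/x],\Delta[y/x]$ denote uniform replacement of $x$ by $y$. There are no rules for $\neg,\vee$: $\neg A$ abbreviates $A\to\bot$ and $A\vee B$ abbreviates $\neg A\to B$. Rules of $LS_{PASL}$ (premises $\Rightarrow$ conclusion; "fresh" = a label variable not occurring in the conclusion): $id$: axiom $\mathcal{G};\Gamma,w:p\vdash w:p,\Delta$. $cut$: $\mathcal{G};\Gamma\vdash x:A,\Delta$ and $\mathcal{G}';\Gamma',x:A\vdash\Delta'$ $\Rightarrow$ $\mathcal{G},\mathcal{G}';\Gamma,\Gamma'\vdash\Delta,\Delta'$. $\bot L$: axiom $\mathcal{G};\Gamma,w:\bot\vdash\Delta$. $\top R$: axiom $\mathcal{G};\Gamma\vdash w:\top,\Delta$. $\top^*R$: axiom $\mathcal{G};\Gamma\vdash\epsilon:\top^*,\Delta$.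 $\top^*L$: $(\epsilon,w\triangleright\epsilon),\mathcal{G};\Gamma\vdash\Delta\Rightarrow\mathcal{G};\Gamma,w:\top^*\vdash\Delta$. $\wedge L$: $\mathcal{G};\Gamma,w:A,w:B\vdash\Delta\Rightarrow\mathcal{G};\Gamma,w:A\wedge B\vdash\Delta$. $\wedge R$: $\mathcal{G};\Gamma\vdash w:A,\Delta$ and $\mathcal{G};\Gamma\vdash w:B,\Delta\Rightarrow\mathcal{G};\Gamma\vdash w:A\wedge B,\Delta$. $\to L$: $\mathcal{G};\Gamma\vdash w:A,\Delta$ and $\mathcal{G};\Gamma,w:B\vdash\Delta\Rightarrow\mathcal{G};\Gamma,w:A\to B\vdash\Delta$. $\to R$: $\mathcal{G};\Gamma,w:A\vdash w:B,\Delta\Rightarrow\mathcal{G};\Gamma\vdash w:A\to B,\Delta$. $*L$: $(x,y\triangleright z),\mathcal{G};\Gamma,x:A,y:B\vdash\Delta\Rightarrow\mathcal{G};\Gamma,z:A*B\vdash\Delta$ ($x,y$ fresh). $\mathrel{ -\!\!*}R$: $(x,z\triangleright y),\mathcal{G};\Gamma,x:A\vdash y:B,\Delta\Rightarrow\mathcal{G};\Gamma\vdash z:A\mathrel{ -\!\!*}B,\Delta$ ($x,y$ fresh). $*R$: $(x,y\triangleright z),\mathcal{G};\Gamma\vdash x:A,z:A*B,\Delta$ and $(x,y\triangleright z),\mathcal{G};\Gamma\vdash y:B,z:A*B,\Delta\Rightarrow(x,y\triangleright z),\mathcal{G};\Gamma\vdash z:A*B,\Delta$. $\mathrel{ -\!\!*}L$: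 $(x,y\triangleright z),\mathcal{G};\Gamma,y:A\mathrel{ -\!\!*}B\vdash x:A,\Delta$ and $(x,y\triangleright z),\mathcal{G};\Gamma,y:A\mathrel{ -\!\!*}B,z:B\vdash\Delta\Rightarrow(x,y\triangleright z),\mathcal{G};\Gamma,y:A\mathrel{ -\!\!*}B\vdash\Delta$. $E$: $(y,x\triangleright z),(x,y\triangleright z),\mathcal{G};\Gamma\vdash\Delta\Rightarrow(x,y\triangleright z),\mathcal{G};\Gamma\vdash\Delta$. $A$: $(u,w\triangleright z),(y,v\triangleright w),(x,y\triangleright z),(u,v\triangleright x),\mathcal{G};\Gamma\vdash\Delta\Rightarrow(x,y\triangleright z),(u,v\triangleright x),\mathcal{G};\Gamma\vdash\Delta$ ($w$ fresh). $U$: $(x,\epsilon\triangleright x),\mathcal{G};\Gamma\vdash\Delta\Rightarrow\mathcal{G};\Gamma\vdash\Delta$. $A_C$: $(x,w\triangleright x),(y,y\triangleright w),(x,y\triangleright x),\mathcal{G};\Gamma\vdash\Delta\Rightarrow(x,y\triangleright x),\mathcal{G};\Gamma\vdash\Delta$ ($w$ fresh). $Eq_1$: $(\epsilon,w'\triangleright w'),\mathcal{G}[w'/w];\Gamma[w'/w]\vdash\Delta[w'/w]\Rightarrow(\epsilon,w\triangleright w'),\mathcal{G};\Gamma\vdash\Delta$. $Eq_2$: same premise $\Rightarrow(\epsilon,w'\triangleright w),\mathcal{G};\Gamma\vdash\Delta$. $P$: $(x,y\triangleright z),\mathcal{G}[z/w];\Gamma[z/w]\vdash\Delta[z/w]\Rightarrow(x,y\triangleright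 z),(x,y\triangleright w),\mathcal{G};\Gamma\vdash\Delta$. $C$: $(x,y\triangleright z),\mathcal{G}[y/w];\Gamma[y/w]\vdash\Delta[y/w]\Rightarrow(x,y\triangleright z),(x,w\triangleright z),\mathcal{G};\Gamma\vdash\Delta$. In $Eq_1,Eq_2,P,C$ the label $w$ substituted for must be a label variable. -}

module Defs where

open import Data.Nat using (ℕ)
open import Data.Bool using (Bool; true; false)
open import Data.Product using (_×_; _,_)
open import Data.List using (List; []; _∷_; _++_; map)
open import Data.List.Membership.Propositional using (_∈_; _∉_)
open import Data.List.Relation.Binary.Permutation.Propositional using (_↭_)
open import Relation.Binary.PropositionalEquality using (_≡_)
open import Data.Nat using (_≟_)
open import Relation.Nullary using (yes; no; ¬_)

_≢ℕ_ : ℕ → ℕ → Set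
x ≢ℕ y = ¬ (x ≡ y)

data Formula : Set where
  pv    : ℕ → Formula
  ⊤f ⊥f : Formula
  _∧f_  : Formula → Formula → Formula
  _⇒f_  : Formula → Formula → Formula
  ⊤*    : Formula
  _✶_   : Formula → Formula → Formula
  _-✶_  : Formula → Formula → Formula

¬f_ : Formula → Formula
¬f A = A ⇒f ⊥f

_∨f_ : Formula → Formula → Formula
A ∨f B = (¬f A) ⇒f B

data Label : Set where
  ε   : Label
  lv  : ℕ → Label

record LFormula : Set where
  constructor _∶_
  field
    lab : Label
    fml : Formula

record RAtom : Set where
  constructor ⟨_,_▷_⟩
  field
    l₁ l₂ l₃ : Label

-- A sequent G ; Γ ⊢ Δ.  G is a set (list up to set equality),
-- Γ and Δ are multisets (lists up to permutation), see _≈S_ below.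
infix 3 _⨾_⊢_
infix 6 _∶_
infixr 7 _⇒f_
infixr 8 _∧f_ _✶_ _-✶_

record Sequent : Set where
  constructor _⨾_⊢_
  field
    rels : List RAtom
    ante : List LFormula
    succ : List LFormula

substL : Label → ℕ → Label → Label
substL y x ε = ε
substL y x (lv n) with n ≟ x
... | yes _ = y
... | no  _ = lv n

substR : Label → ℕ → RAtom → RAtom
substR y x ⟨ a , b ▷ c ⟩ = ⟨ substL y x a , substL y x b ▷ substL y x c ⟩

substF : Label → ℕ → LFormula → LFormula
substF y x (a ∶ A) = substL y x a ∶ A

substG : Label → ℕ → List RAtom → List RAtom
substG y x = map (substR y x)

substΓ : Label → ℕ → List LFormula → List LFormula
substΓ y x = map (substF y x)

labelsR : RAtom → List Label
labelsR ⟨ a , b ▷ c ⟩ = a ∷ b ∷ c ∷ []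

labelsG : List RAtom → List Label
labelsG [] = []
labelsG (r ∷ G) = labelsR r ++ labelsG G

labelsΓ : List LFormula → List Label
labelsΓ [] = []
labelsΓ ((a ∶ _) ∷ Γ) = a ∷ labelsΓ Γ

labelsS : Sequent → List Label
labelsS (G ⨾ Γ ⊢ Δ) = labelsG G ++ labelsΓ Γ ++ labelsΓ Δ

Fresh : ℕ → Sequent → Set
Fresh x s = lv x ∉ labelsS s

_⊆G_ : List RAtom → List RAtom → Set
G ⊆G H = ∀ {r} → r ∈ G → r ∈ H

_≈S_ : Sequent → Sequent → Set
(G ⨾ Γ ⊢ Δ) ≈S (G' ⨾ Γ' ⊢ Δ') =
  (G ⊆G G') × (G' ⊆G G) × (Γ ↭ Γ') × (Δ ↭ Δ')

-- The Bool index says whether cut is permitted: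
-- Deriv true s  = s derivable in LS_PASL,
-- Deriv false s = s derivable in LS_PASL without cut.
-- The rules are stated with the principal parts at the front of the
-- lists; together with the rule `reorder` (sequents are identified up to
-- set/multiset equality) this is exactly the rule set of LS_PASL.

data Deriv (c : Bool) : Sequent → Set where
  reorder : ∀ {s s'} → s ≈S s' → Deriv c s → Deriv c s'
  id  : ∀ {G Γ Δ w p} → Deriv c (G ⨾ (w ∶ pv p) ∷ Γ ⊢ (w ∶ pv p) ∷ Δ)
  cut : ∀ {G G' Γ Γ' Δ Δ' x A} → c ≡ true →
        Deriv c (G ⨾ Γ ⊢ (x ∶ A) ∷ Δ) → Deriv c (G' ⨾ (x ∶ A) ∷ Γ' ⊢ Δ') →
        Deriv c (G ++ G' ⨾ Γ ++ Γ' ⊢ Δ ++ Δ')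
  ⊥L  : ∀ {G Γ Δ w} → Deriv c (G ⨾ (w ∶ ⊥f) ∷ Γ ⊢ Δ)
  ⊤R  : ∀ {G Γ Δ w} → Deriv c (G ⨾ Γ ⊢ (w ∶ ⊤f) ∷ Δ)
  ⊤*R : ∀ {G Γ Δ} → Deriv c (G ⨾ Γ ⊢ (ε ∶ ⊤*) ∷ Δ)
  ⊤*L : ∀ {G Γ Δ w} → Deriv c (⟨ ε , w ▷ ε ⟩ ∷ G ⨾ Γ ⊢ Δ) →
        Deriv c (G ⨾ (w ∶ ⊤*) ∷ Γ ⊢ Δ)
  ∧L  : ∀ {G Γ Δ w A B} → Deriv c (G ⨾ (w ∶ A) ∷ (w ∶ B) ∷ Γ ⊢ Δ) →
        Deriv c (G ⨾ (w ∶ (A ∧f B)) ∷ Γ ⊢ Δ)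
  ∧R  : ∀ {G Γ Δ w A B} → Deriv c (G ⨾ Γ ⊢ (w ∶ A) ∷ Δ) →
        Deriv c (G ⨾ Γ ⊢ (w ∶ B) ∷ Δ) → Deriv c (G ⨾ Γ ⊢ (w ∶ (A ∧f B)) ∷ Δ)
  ⇒L  : ∀ {G Γ Δ w A B} → Deriv c (G ⨾ Γ ⊢ (w ∶ A) ∷ Δ) →
        Deriv c (G ⨾ (w ∶ B) ∷ Γ ⊢ Δ) → Deriv c (G ⨾ (w ∶ (A ⇒f B)) ∷ Γ ⊢ Δ)
  ⇒R  : ∀ {G Γ Δ w A B} → Deriv c (G ⨾ (w ∶ A) ∷ Γ ⊢ (w ∶ B) ∷ Δ) →
        Deriv c (G ⨾ Γ ⊢ (w ∶ (A ⇒f B)) ∷ Δ)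
  ✶L  : ∀ {G Γ Δ x y z A B} →
        Fresh x (G ⨾ (z ∶ (A ✶ B)) ∷ Γ ⊢ Δ) →
        Fresh y (G ⨾ (z ∶ (A ✶ B)) ∷ Γ ⊢ Δ) → x ≢ℕ y →
        Deriv c (⟨ lv x , lv y ▷ z ⟩ ∷ G ⨾ (lv x ∶ A) ∷ (lv y ∶ B) ∷ Γ ⊢ Δ) →
        Deriv c (G ⨾ (z ∶ (A ✶ B)) ∷ Γ ⊢ Δ)
  -✶R : ∀ {G Γ Δ x y z A B} →
        Fresh x (G ⨾ Γ ⊢ (z ∶ (A -✶ B)) ∷ Δ) →
        Fresh y (G ⨾ Γ ⊢ (z ∶ (A -✶ B)) ∷ Δ) → x ≢ℕ y →
        Deriv c (⟨ lv x , z ▷ lv y ⟩ ∷ G ⨾ (lv x ∶ A) ∷ Γ ⊢ (lv y ∶ B) ∷ Δ) →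
        Deriv c (G ⨾ Γ ⊢ (z ∶ (A -✶ B)) ∷ Δ)
  ✶R  : ∀ {G Γ Δ x y z A B} →
        Deriv c (⟨ x , y ▷ z ⟩ ∷ G ⨾ Γ ⊢ (x ∶ A) ∷ (z ∶ (A ✶ B)) ∷ Δ) →
        Deriv c (⟨ x , y ▷ z ⟩ ∷ G ⨾ Γ ⊢ (y ∶ B) ∷ (z ∶ (A ✶ B)) ∷ Δ) →
        Deriv c (⟨ x , y ▷ z ⟩ ∷ G ⨾ Γ ⊢ (z ∶ (A ✶ B)) ∷ Δ)
  -✶L : ∀ {G Γ Δ x y z A B} →
        Deriv c (⟨ x , y ▷ z ⟩ ∷ G ⨾ (y ∶ (A -✶ B)) ∷ Γ ⊢ (x ∶ A) ∷ Δ) →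
        Deriv c (⟨ x , y ▷ z ⟩ ∷ G ⨾ (y ∶ (A -✶ B)) ∷ (z ∶ B) ∷ Γ ⊢ Δ) →
        Deriv c (⟨ x , y ▷ z ⟩ ∷ G ⨾ (y ∶ (A -✶ B)) ∷ Γ ⊢ Δ)
  E   : ∀ {G Γ Δ x y z} →
        Deriv c (⟨ y , x ▷ z ⟩ ∷ ⟨ x , y ▷ z ⟩ ∷ G ⨾ Γ ⊢ Δ) →
        Deriv c (⟨ x , y ▷ z ⟩ ∷ G ⨾ Γ ⊢ Δ)
  A   : ∀ {G Γ Δ x y z u v w} →
        Fresh w (⟨ x , y ▷ z ⟩ ∷ ⟨ u , v ▷ x ⟩ ∷ G ⨾ Γ ⊢ Δ) →
        Deriv c (⟨ u , lv w ▷ z ⟩ ∷ ⟨ y , v ▷ lv w ⟩ ∷ ⟨ x , y ▷ z ⟩ ∷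
                 ⟨ u , v ▷ x ⟩ ∷ G ⨾ Γ ⊢ Δ) →
        Deriv c (⟨ x , y ▷ z ⟩ ∷ ⟨ u , v ▷ x ⟩ ∷ G ⨾ Γ ⊢ Δ)
  U   : ∀ {G Γ Δ x} → Deriv c (⟨ x , ε ▷ x ⟩ ∷ G ⨾ Γ ⊢ Δ) → Deriv c (G ⨾ Γ ⊢ Δ)
  AC  : ∀ {G Γ Δ x y w} →
        Fresh w (⟨ x , y ▷ x ⟩ ∷ G ⨾ Γ ⊢ Δ) →
        Deriv c (⟨ x , lv w ▷ x ⟩ ∷ ⟨ y , y ▷ lv w ⟩ ∷ ⟨ x , y ▷ x ⟩ ∷ G ⨾ Γ ⊢ Δ) →
        Deriv c (⟨ x , y ▷ x ⟩ ∷ G ⨾ Γ ⊢ Δ)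
  Eq₁ : ∀ {G Γ Δ w w'} →
        Deriv c (⟨ ε , w' ▷ w' ⟩ ∷ substG w' w G ⨾ substΓ w' w Γ ⊢ substΓ w' w Δ) →
        Deriv c (⟨ ε , lv w ▷ w' ⟩ ∷ G ⨾ Γ ⊢ Δ)
  Eq₂ : ∀ {G Γ Δ w w'} →
        Deriv c (⟨ ε , w' ▷ w' ⟩ ∷ substG w' w G ⨾ substΓ w' w Γ ⊢ substΓ w' w Δ) →
        Deriv c (⟨ ε , w' ▷ lv w ⟩ ∷ G ⨾ Γ ⊢ Δ)
  P   : ∀ {G Γ Δ x y z w} →
        Deriv c (⟨ x , y ▷ z ⟩ ∷ substG z w G ⨾ substΓ z w Γ ⊢ substΓ z w Δ) →
        Deriv c (⟨ x , y ▷ z ⟩ ∷ ⟨ x , y ▷ lv w ⟩ ∷ G ⨾ Γ ⊢ Δ)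
  C   : ∀ {G Γ Δ x y z w} →
        Deriv c (⟨ x , y ▷ z ⟩ ∷ substG y w G ⨾ substΓ y w Γ ⊢ substΓ y w Δ) →
        Deriv c (⟨ x , y ▷ z ⟩ ∷ ⟨ x , lv w ▷ z ⟩ ∷ G ⨾ Γ ⊢ Δ)

Derivable : Sequent → Set
Derivable = Deriv true

CutFreeDerivable : Sequent → Set
CutFreeDerivable = Deriv false

-- Cut is eliminated by a detour through an auxiliary calculus in which structural reasoning is free.
-- Its sequents are sets of items (relational atoms and labelled formulae on either side), its rules
-- keep their principal items in the premises, its eigenvariable rules quantify over all sufficiently
-- fresh labels, and its derivations carry a height. There weakening, substitution of labels and
-- inversion of the invertible logical rules are height preserving, and cut is admissible by induction
-- on the cut formula and, inside, on the left derivation until the cut formula is principal there and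
-- then on the right one. An LS_PASL derivation embeds into this calculus, its cuts being replaced by
-- admissible cuts; an auxiliary derivation is read back as a cut-free LS_PASL derivation by induction
-- on its height, inversion removing the principal formula that the auxiliary rules retain.

module Submission where

open import Defs renaming (id to id-rule; cut to cut-rule; E to E-rule; A to A-rule; U to U-rule; P to P-rule; C to C-rule)
open import Data.Nat using (ℕ; suc; _≤_; _<_; _⊔_; s≤s; _≟_)
open import Data.Nat.Properties using (≤-trans; m≤m⊔n; m≤n⊔m; <-irrefl; n≤1+n)
open import Data.List using (List; []; _∷_; _++_; map)
open import Data.List.Properties using (map-++; map-∘; map-cong; map-id; ++-assoc)
open import Data.List.Membership.Propositional using (_∈_; _∉_)
open import Data.List.Membership.Propositional.Properties
  using (∈-++⁺ˡ; ∈-++⁺ʳ; ∈-++⁻; ∈-map⁺; ∈-map⁻; ∈-∃++)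
open import Data.List.Relation.Unary.Any using (here; there)
open import Data.List.Relation.Binary.Subset.Propositional using (_⊆_)
open import Data.List.Relation.Binary.Subset.Propositional.Properties
  using (module ⊆-Reasoning; ⊆-refl; ⊆-reflexive; ⊆-trans; ⊆-reflexive-↭; map⁺; ++⁺ʳ; ∷⁺ʳ; ⊆∷⇒∈∨⊆;
         xs⊆ys++xs; xs⊆xs++ys; xs⊆x∷xs)
open import Data.List.Relation.Binary.Permutation.Propositional using (_↭_; ↭-refl; ↭-sym; swap)
open import Data.List.Relation.Binary.Permutation.Propositional.Properties using (shifts; shift)
open import Function using (_∘_)
open import Data.Product using (Σ; _×_; _,_; proj₂)
open import Data.Sum using (_⊎_; inj₁; inj₂)
open import Data.Empty using (⊥; ⊥-elim)
open import Data.Unit using (⊤; tt)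
open import Relation.Nullary using (yes; no)
open import Relation.Binary.PropositionalEquality using (_≡_; _≢_; refl; sym; trans; cong; cong₂; subst)

++-⊆ : ∀ {A : Set} {xs ys zs : List A} → xs ⊆ zs → ys ⊆ zs → xs ++ ys ⊆ zs
++-⊆ {xs = xs} xs⊆ ys⊆ p with ∈-++⁻ xs p
... | inj₁ q = xs⊆ q
... | inj₂ q = ys⊆ q

⊆-singleton : ∀ {A : Set} {x : A} {xs} → x ∈ xs → x ∷ [] ⊆ xs
⊆-singleton p (here refl) = p

⊆-pair : ∀ {A : Set} {x y : A} {xs} → x ∈ xs → y ∈ xs → x ∷ y ∷ [] ⊆ xs
⊆-pair p q (here refl)         = p
⊆-pair p q (there (here refl)) = q

[]⊆ : ∀ {A : Set} {xs : List A} → [] ⊆ xs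
[]⊆ ()

head⊆ : ∀ {A : Set} {x : A} {xs} → x ∷ [] ⊆ x ∷ xs
head⊆ {x = x} = ∷⁺ʳ x []⊆

∷-absorb : ∀ {A : Set} {x : A} {xs} → x ∈ xs → x ∷ xs ⊆ xs
∷-absorb x∈ (here refl) = x∈
∷-absorb x∈ (there p)   = p

++-dup : ∀ {A : Set} (l : List A) {T} → l ++ l ++ T ⊆ l ++ T
++-dup l p with ∈-++⁻ l p
... | inj₁ q = ∈-++⁺ˡ q
... | inj₂ q = q

shift-⊆ : ∀ {A : Set} (xs ys : List A) {zs} → xs ++ ys ++ zs ⊆ ys ++ xs ++ zs
shift-⊆ xs ys = ⊆-reflexive-↭ (shifts xs ys)

pick : ∀ {A : Set} {x : A} {xs} → x ∈ xs → Σ (List A) λ ys → xs ↭ x ∷ ys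
pick p with ∈-∃++ p
... | ys , zs , refl = ys ++ zs , shift _ ys zs

∈-∷-≢ : ∀ {A : Set} {ψ φ : A} {T} → ψ ∈ φ ∷ T → ψ ≢ φ → ψ ∈ T
∈-∷-≢ (here ψ≡φ) ψ≢φ = ⊥-elim (ψ≢φ ψ≡φ)
∈-∷-≢ (there p)  _   = p

cover-++ : ∀ {A : Set} {φ : A} {S T} l → S ⊆ φ ∷ T → l ++ S ⊆ φ ∷ (l ++ T)
cover-++ l cov p with ∈-++⁻ l p
... | inj₁ q = there (∈-++⁺ˡ q)
... | inj₂ q with cov q
...   | here e  = here e
...   | there r = there (∈-++⁺ʳ l r)

weaken-cover : ∀ {A : Set} {φ : A} {S T} l → S ⊆ φ ∷ T → S ⊆ φ ∷ (l ++ T)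
weaken-cover {φ = φ} {T = T} l cov = ⊆-trans cov (∷⁺ʳ φ (xs⊆ys++xs T l))

cover-tail : ∀ {A : Set} {φ ψ : A} {T} → φ ∷ T ⊆ φ ∷ ψ ∷ T
cover-tail {φ = φ} {ψ} {T} = ∷⁺ʳ φ (xs⊆x∷xs T ψ)

data Item : Set where
  rel   : RAtom → Item
  left  : LFormula → Item
  right : LFormula → Item

Items : Set
Items = List Item

items : Sequent → Items
items (G ⨾ Γ ⊢ Δ) = map rel G ++ map left Γ ++ map right Δ

_⊕_ : Sequent → Sequent → Sequent
(G ⨾ Γ ⊢ Δ) ⊕ (G' ⨾ Γ' ⊢ Δ') = G ++ G' ⨾ Γ ++ Γ' ⊢ Δ ++ Δ'

_⊑_ : Sequent → Sequent → Set
(G ⨾ Γ ⊢ Δ) ⊑ (G' ⨾ Γ' ⊢ Δ') = G ⊆ G' × Γ ⊆ Γ' × Δ ⊆ Δ'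

_∈ₛ_ : Item → Sequent → Set
rel r   ∈ₛ (G ⨾ _ ⊢ _) = r ∈ G
left f  ∈ₛ (_ ⨾ Γ ⊢ _) = f ∈ Γ
right f ∈ₛ (_ ⨾ _ ⊢ Δ) = f ∈ Δ

∈-items⁺ : ∀ {i} s → i ∈ₛ s → i ∈ items s
∈-items⁺ {rel _}   (G ⨾ Γ ⊢ Δ) p = ∈-++⁺ˡ (∈-map⁺ rel p)
∈-items⁺ {left _}  (G ⨾ Γ ⊢ Δ) p = ∈-++⁺ʳ (map rel G) (∈-++⁺ˡ (∈-map⁺ left p))
∈-items⁺ {right _} (G ⨾ Γ ⊢ Δ) p = ∈-++⁺ʳ (map rel G) (∈-++⁺ʳ (map left Γ) (∈-map⁺ right p))

∈-items⁻ : ∀ {i} s → i ∈ items s → i ∈ₛ s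
∈-items⁻ (G ⨾ Γ ⊢ Δ) p with ∈-++⁻ (map rel G) p
... | inj₁ q with ∈-map⁻ rel q
...   | _ , r∈G , refl = r∈G
∈-items⁻ (G ⨾ Γ ⊢ Δ) p | inj₂ q with ∈-++⁻ (map left Γ) q
... | inj₁ q' with ∈-map⁻ left q'
...   | _ , f∈Γ , refl = f∈Γ
∈-items⁻ (G ⨾ Γ ⊢ Δ) p | inj₂ q | inj₂ q' with ∈-map⁻ right q'
...   | _ , f∈Δ , refl = f∈Δ

∈ₛ-mono : ∀ {i s s'} → s ⊑ s' → i ∈ₛ s → i ∈ₛ s'
∈ₛ-mono {rel _}   {G ⨾ Γ ⊢ Δ} {G' ⨾ Γ' ⊢ Δ'} (G⊆ , _ , _) p = G⊆ p
∈ₛ-mono {left _}  {G ⨾ Γ ⊢ Δ} {G' ⨾ Γ' ⊢ Δ'} (_ , Γ⊆ , _) p = Γ⊆ p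
∈ₛ-mono {right _} {G ⨾ Γ ⊢ Δ} {G' ⨾ Γ' ⊢ Δ'} (_ , _ , Δ⊆) p = Δ⊆ p

∈ₛ-⊕⁻ : ∀ {i} s₁ s₂ → i ∈ₛ (s₁ ⊕ s₂) → i ∈ₛ s₁ ⊎ i ∈ₛ s₂
∈ₛ-⊕⁻ {rel _}   (G ⨾ Γ ⊢ Δ) (_ ⨾ _ ⊢ _) = ∈-++⁻ G
∈ₛ-⊕⁻ {left _}  (G ⨾ Γ ⊢ Δ) (_ ⨾ _ ⊢ _) = ∈-++⁻ Γ
∈ₛ-⊕⁻ {right _} (G ⨾ Γ ⊢ Δ) (_ ⨾ _ ⊢ _) = ∈-++⁻ Δ

∈ₛ-⊕⁺ : ∀ {i} s₁ s₂ → i ∈ₛ s₁ ⊎ i ∈ₛ s₂ → i ∈ₛ (s₁ ⊕ s₂)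
∈ₛ-⊕⁺ {rel _}   (G ⨾ Γ ⊢ Δ) (_ ⨾ _ ⊢ _) (inj₁ p) = ∈-++⁺ˡ p
∈ₛ-⊕⁺ {rel _}   (G ⨾ Γ ⊢ Δ) (_ ⨾ _ ⊢ _) (inj₂ p) = ∈-++⁺ʳ G p
∈ₛ-⊕⁺ {left _}  (G ⨾ Γ ⊢ Δ) (_ ⨾ _ ⊢ _) (inj₁ p) = ∈-++⁺ˡ p
∈ₛ-⊕⁺ {left _}  (G ⨾ Γ ⊢ Δ) (_ ⨾ _ ⊢ _) (inj₂ p) = ∈-++⁺ʳ Γ p
∈ₛ-⊕⁺ {right _} (G ⨾ Γ ⊢ Δ) (_ ⨾ _ ⊢ _) (inj₁ p) = ∈-++⁺ˡ p
∈ₛ-⊕⁺ {right _} (G ⨾ Γ ⊢ Δ) (_ ⨾ _ ⊢ _) (inj₂ p) = ∈-++⁺ʳ Δ p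

items-mono : ∀ {s s'} → s ⊑ s' → items s ⊆ items s'
items-mono {s} {s'} s⊑s' p = ∈-items⁺ s' (∈ₛ-mono s⊑s' (∈-items⁻ s p))

items-⊕⁻ : ∀ s₁ s₂ → items (s₁ ⊕ s₂) ⊆ items s₁ ++ items s₂
items-⊕⁻ s₁ s₂ p with ∈ₛ-⊕⁻ s₁ s₂ (∈-items⁻ (s₁ ⊕ s₂) p)
... | inj₁ q = ∈-++⁺ˡ (∈-items⁺ s₁ q)
... | inj₂ q = ∈-++⁺ʳ (items s₁) (∈-items⁺ s₂ q)

items-⊕⁺ : ∀ s₁ s₂ → items s₁ ++ items s₂ ⊆ items (s₁ ⊕ s₂)
items-⊕⁺ s₁ s₂ p with ∈-++⁻ (items s₁) p
... | inj₁ q = ∈-items⁺ (s₁ ⊕ s₂) (∈ₛ-⊕⁺ s₁ s₂ (inj₁ (∈-items⁻ s₁ q)))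
... | inj₂ q = ∈-items⁺ (s₁ ⊕ s₂) (∈ₛ-⊕⁺ s₁ s₂ (inj₂ (∈-items⁻ s₂ q)))

labelsI : Item → List Label
labelsI (rel r)         = labelsR r
labelsI (left (a ∶ _))  = a ∷ []
labelsI (right (a ∶ _)) = a ∷ []

labels : Items → List Label
labels []      = []
labels (i ∷ S) = labelsI i ++ labels S

labels-++ : ∀ S T → labels (S ++ T) ≡ labels S ++ labels T
labels-++ []      T = refl
labels-++ (i ∷ S) T = trans (cong (labelsI i ++_) (labels-++ S T)) (sym (++-assoc (labelsI i) (labels S) (labels T)))

labels-∈ : ∀ {i ℓ} S → i ∈ S → ℓ ∈ labelsI i → ℓ ∈ labels S
labels-∈ (i ∷ S) (here refl) q = ∈-++⁺ˡ q
labels-∈ (j ∷ S) (there p)   q = ∈-++⁺ʳ (labelsI j) (labels-∈ S p q)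

labels-mono : ∀ {S T} → S ⊆ T → labels S ⊆ labels T
labels-mono {i ∷ S} S⊆T q with ∈-++⁻ (labelsI i) q
... | inj₁ q' = labels-∈ _ (S⊆T (here refl)) q'
... | inj₂ q' = labels-mono (λ p → S⊆T (there p)) q'

labels-items : ∀ s → labels (items s) ≡ labelsS s
labels-items (G ⨾ Γ ⊢ Δ) =
  trans (labels-++ (map rel G) _)
        (cong₂ _++_ (labels-rels G) (trans (labels-++ (map left Γ) _) (cong₂ _++_ (labels-left Γ) (labels-right Δ))))
  where
  labels-rels : ∀ G → labels (map rel G) ≡ labelsG G
  labels-rels []      = refl
  labels-rels (r ∷ G) = cong (labelsR r ++_) (labels-rels G)
  labels-left : ∀ Γ → labels (map left Γ) ≡ labelsΓ Γ
  labels-left []             = refl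
  labels-left ((a ∶ _) ∷ Γ) = cong (a ∷_) (labels-left Γ)
  labels-right : ∀ Δ → labels (map right Δ) ≡ labelsΓ Δ
  labels-right []             = refl
  labels-right ((a ∶ _) ∷ Δ) = cong (a ∷_) (labels-right Δ)

Subst : Set
Subst = ℕ → Label

applyL : Subst → Label → Label
applyL σ ε      = ε
applyL σ (lv x) = σ x

applyR : Subst → RAtom → RAtom
applyR σ ⟨ a , b ▷ c ⟩ = ⟨ applyL σ a , applyL σ b ▷ applyL σ c ⟩

applyF : Subst → LFormula → LFormula
applyF σ (a ∶ A) = applyL σ a ∶ A

applyI : Subst → Item → Item
applyI σ (rel r)   = rel (applyR σ r)
applyI σ (left f)  = left (applyF σ f)
applyI σ (right f) = right (applyF σ f)

apply : Subst → Items → Items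
apply σ = map (applyI σ)

ids : Subst
ids = lv

extend : ℕ → Label → Subst → Subst
extend x a σ y with y ≟ x
... | yes _ = a
... | no  _ = σ y

_≔_ : ℕ → Label → Subst
x ≔ a = extend x a ids

_≫_ : Subst → Subst → Subst
(σ ≫ τ) x = applyL τ (σ x)

applyL-≫ : ∀ σ τ ℓ → applyL τ (applyL σ ℓ) ≡ applyL (σ ≫ τ) ℓ
applyL-≫ σ τ ε      = refl
applyL-≫ σ τ (lv _) = refl

applyI-≫ : ∀ σ τ i → applyI τ (applyI σ i) ≡ applyI (σ ≫ τ) i
applyI-≫ σ τ (rel ⟨ a , b ▷ c ⟩) rewrite applyL-≫ σ τ a | applyL-≫ σ τ b | applyL-≫ σ τ c = refl
applyI-≫ σ τ (left (a ∶ _))  rewrite applyL-≫ σ τ a = refl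
applyI-≫ σ τ (right (a ∶ _)) rewrite applyL-≫ σ τ a = refl

apply-≫ : ∀ σ τ S → apply τ (apply σ S) ≡ apply (σ ≫ τ) S
apply-≫ σ τ S = trans (sym (map-∘ S)) (map-cong (applyI-≫ σ τ) S)

Agree : Subst → Subst → List Label → Set
Agree σ τ L = ∀ {x} → lv x ∈ L → σ x ≡ τ x

applyL-agree : ∀ {σ τ} ℓ → Agree σ τ (ℓ ∷ []) → applyL σ ℓ ≡ applyL τ ℓ
applyL-agree ε      _  = refl
applyL-agree (lv _) eq = eq (here refl)

applyI-agree : ∀ {σ τ} i → Agree σ τ (labelsI i) → applyI σ i ≡ applyI τ i
applyI-agree (rel ⟨ a , b ▷ c ⟩) eq
  rewrite applyL-agree a (λ p → eq (∈-++⁺ˡ p))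
        | applyL-agree b (λ p → eq (there (∈-++⁺ˡ p)))
        | applyL-agree c (λ p → eq (there (there p))) = refl
applyI-agree (left (a ∶ _))  eq rewrite applyL-agree a eq = refl
applyI-agree (right (a ∶ _)) eq rewrite applyL-agree a eq = refl

apply-agree : ∀ {σ τ} S → Agree σ τ (labels S) → apply σ S ≡ apply τ S
apply-agree []      eq = refl
apply-agree (i ∷ S) eq = cong₂ _∷_ (applyI-agree i (λ p → eq (∈-++⁺ˡ p)))
                                   (apply-agree S (λ p → eq (∈-++⁺ʳ (labelsI i) p)))

applyL-ids : ∀ ℓ → applyL ids ℓ ≡ ℓ
applyL-ids ε      = refl
applyL-ids (lv _) = refl

applyI-ids : ∀ i → applyI ids i ≡ i
applyI-ids (rel ⟨ a , b ▷ c ⟩) rewrite applyL-ids a | applyL-ids b | applyL-ids c = refl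
applyI-ids (left (a ∶ _))  rewrite applyL-ids a = refl
applyI-ids (right (a ∶ _)) rewrite applyL-ids a = refl

apply-ids : ∀ S → apply ids S ≡ S
apply-ids S = trans (map-cong applyI-ids S) (map-id S)

extend-here : ∀ x a σ → extend x a σ x ≡ a
extend-here x a σ with x ≟ x
... | yes _  = refl
... | no x≢x = ⊥-elim (x≢x refl)

extend-there : ∀ {x y} a σ → y ≢ x → extend x a σ y ≡ σ y
extend-there {x} {y} a σ y≢x with y ≟ x
... | yes y≡x = ⊥-elim (y≢x y≡x)
... | no  _   = refl

extend-agree : ∀ {x L} a σ → lv x ∉ L → Agree (extend x a σ) σ L
extend-agree a σ x∉L y∈L = extend-there a σ λ { refl → x∉L y∈L }

≔-idem : ∀ x a → applyL (x ≔ a) a ≡ a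
≔-idem x ε      = refl
≔-idem x (lv y) with y ≟ x
... | yes refl = refl
... | no  _    = refl

apply-++ : ∀ σ S T → apply σ (S ++ T) ≡ apply σ S ++ apply σ T
apply-++ σ = map-++ (applyI σ)

apply-≔-unifier : ∀ {x a} τ S → applyL τ a ≡ τ x → apply τ (apply (x ≔ a) S) ≡ apply τ S
apply-≔-unifier {x} {a} τ S unifies = trans (apply-≫ (x ≔ a) τ S) (apply-agree S λ {y} _ → at y)
  where
  at : ∀ y → applyL τ ((x ≔ a) y) ≡ τ y
  at y with y ≟ x
  ... | yes refl = unifies
  ... | no  _    = refl

-- After a substitution, the variable that an Eq, P or C instance eliminates may have become ε:
-- then the other label is eliminated instead, or the instance has become trivial.
unifier : Label → Label → Subst
unifier (lv k) b      = k ≔ b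
unifier ε      (lv k) = k ≔ ε
unifier ε      ε      = ids

unifier-unifies : ∀ a b → applyL (unifier a b) b ≡ applyL (unifier a b) a
unifier-unifies (lv k) b      = trans (≔-idem k b) (sym (extend-here k b ids))
unifier-unifies ε      (lv k) = extend-here k ε ids
unifier-unifies ε      ε      = refl

substL-≔ : ∀ a x ℓ → substL a x ℓ ≡ applyL (x ≔ a) ℓ
substL-≔ a x ε      = refl
substL-≔ a x (lv y) with y ≟ x
... | yes _ = refl
... | no  _ = refl

items-substitute : ∀ a x G Γ Δ →
  items (substG a x G ⨾ substΓ a x Γ ⊢ substΓ a x Δ) ≡ apply (x ≔ a) (items (G ⨾ Γ ⊢ Δ))
items-substitute a x G Γ Δ
  rewrite map-++ (applyI (x ≔ a)) (map rel G) (map left Γ ++ map right Δ)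
        | map-++ (applyI (x ≔ a)) (map left Γ) (map right Δ) =
  cong₂ _++_ (rels G) (cong₂ _++_ (lefts Γ) (rights Δ))
  where
  rels : ∀ G → map rel (substG a x G) ≡ apply (x ≔ a) (map rel G)
  rels []                  = refl
  rels (⟨ b , c ▷ d ⟩ ∷ G) rewrite substL-≔ a x b | substL-≔ a x c | substL-≔ a x d = cong (_ ∷_) (rels G)
  lefts : ∀ Γ → map left (substΓ a x Γ) ≡ apply (x ≔ a) (map left Γ)
  lefts []             = refl
  lefts ((b ∶ _) ∷ Γ) rewrite substL-≔ a x b = cong (_ ∷_) (lefts Γ)
  rights : ∀ Δ → map right (substΓ a x Δ) ≡ apply (x ≔ a) (map right Δ)
  rights []             = refl
  rights ((b ∶ _) ∷ Δ) rewrite substL-≔ a x b = cong (_ ∷_) (rights Δ)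

extend₂ : ℕ → ℕ → Label → Label → Subst → Subst
extend₂ x y a b σ = extend x a (extend y b σ)

extend₂-x : ∀ x y a b σ → extend₂ x y a b σ x ≡ a
extend₂-x x y a b σ = extend-here x a _

extend₂-y : ∀ {x y} a b σ → x ≢ y → extend₂ x y a b σ y ≡ b
extend₂-y {x} {y} a b σ x≢y = trans (extend-there a _ (λ e → x≢y (sym e))) (extend-here y b σ)

extend₂-agree : ∀ {x y L} a b σ → lv x ∉ L → lv y ∉ L → Agree (extend₂ x y a b σ) σ L
extend₂-agree a b σ x∉L y∉L p = trans (extend-agree a _ x∉L p) (extend-agree b σ y∉L p)

extend₂-param : ∀ {x y L ℓ} a b σ → lv x ∉ L → lv y ∉ L → ℓ ∈ L →
                applyL (extend₂ x y a b σ) ℓ ≡ applyL σ ℓ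
extend₂-param {ℓ = ε}    a b σ x∉L y∉L ℓ∈L = refl
extend₂-param {ℓ = lv _} a b σ x∉L y∉L ℓ∈L = extend₂-agree a b σ x∉L y∉L ℓ∈L

index : Label → ℕ
index ε      = 0
index (lv x) = x

fresh : List Label → ℕ
fresh []      = 0
fresh (ℓ ∷ L) = suc (index ℓ) ⊔ fresh L

fresh-∉ : ∀ L → lv (fresh L) ∉ L
fresh-∉ L p = <-irrefl refl (below L p)
  where
  below : ∀ {x} L → lv x ∈ L → x < fresh L
  below (ℓ ∷ L) (here refl) = m≤m⊔n _ (fresh L)
  below (ℓ ∷ L) (there p)   = ≤-trans (below L p) (m≤n⊔m _ (fresh L))

record Fresh₂ (L₁ L₂ L₃ : List Label) : Set where
  field
    x₀ y₀ : ℕ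
    x₀≢y₀ : x₀ ≢ y₀
    x₀∉₁  : lv x₀ ∉ L₁
    x₀∉₂  : lv x₀ ∉ L₂
    x₀∉₃  : lv x₀ ∉ L₃
    y₀∉₁  : lv y₀ ∉ L₁
    y₀∉₂  : lv y₀ ∉ L₂
    y₀∉₃  : lv y₀ ∉ L₃

fresh₂ : ∀ L₁ L₂ L₃ → Fresh₂ L₁ L₂ L₃
fresh₂ L₁ L₂ L₃ = record
  { x₀ = x ; y₀ = y ; x₀≢y₀ = λ e → fresh-∉ (lv x ∷ L) (here (cong lv (sym e)))
  ; x₀∉₁ = ∉₁ x∉ ; x₀∉₂ = ∉₂ x∉ ; x₀∉₃ = ∉₃ x∉
  ; y₀∉₁ = ∉₁ y∉ ; y₀∉₂ = ∉₂ y∉ ; y₀∉₃ = ∉₃ y∉ }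
  where
  L = L₁ ++ L₂ ++ L₃
  x = fresh L
  y = fresh (lv x ∷ L)
  x∉ : lv x ∉ L
  x∉ = fresh-∉ L
  y∉ : lv y ∉ L
  y∉ p = fresh-∉ (lv x ∷ L) (there p)
  ∉₁ : ∀ {ℓ} → ℓ ∉ L → ℓ ∉ L₁
  ∉₁ ℓ∉ p = ℓ∉ (∈-++⁺ˡ p)
  ∉₂ : ∀ {ℓ} → ℓ ∉ L → ℓ ∉ L₂
  ∉₂ ℓ∉ p = ℓ∉ (∈-++⁺ʳ L₁ (∈-++⁺ˡ p))
  ∉₃ : ∀ {ℓ} → ℓ ∉ L → ℓ ∉ L₃
  ∉₃ ℓ∉ p = ℓ∉ (∈-++⁺ʳ L₁ (∈-++⁺ʳ L₂ p))

data Rule : Set where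
  rId       : Label → ℕ → Rule
  rL rR     : Label → Formula → Rule
  r✶R r-✶L  : Label → Label → Label → Formula → Formula → Rule
  rE        : Label → Label → Label → Rule
  rA        : Label → Label → Label → Label → Label → Rule
  rU        : Label → Rule
  rAC       : Label → Label → Rule
  rEq₁ rEq₂ : ℕ → Label → Rule
  rP rC     : Label → Label → Label → ℕ → Rule

principal : Rule → Sequent
principal (rId w p)        = [] ⨾ w ∶ pv p ∷ [] ⊢ w ∶ pv p ∷ []
principal (rL w A)         = [] ⨾ w ∶ A ∷ [] ⊢ []
principal (rR w A)         = [] ⨾ [] ⊢ w ∶ A ∷ []
principal (r✶R x y z A B)  = ⟨ x , y ▷ z ⟩ ∷ [] ⨾ [] ⊢ z ∶ A ✶ B ∷ []
principal (r-✶L x y z A B) = ⟨ x , y ▷ z ⟩ ∷ [] ⨾ y ∶ A -✶ B ∷ [] ⊢ []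
principal (rE x y z)       = ⟨ x , y ▷ z ⟩ ∷ [] ⨾ [] ⊢ []
principal (rA x y z u v)   = ⟨ x , y ▷ z ⟩ ∷ ⟨ u , v ▷ x ⟩ ∷ [] ⨾ [] ⊢ []
principal (rU x)           = [] ⨾ [] ⊢ []
principal (rAC x y)        = ⟨ x , y ▷ x ⟩ ∷ [] ⨾ [] ⊢ []
principal (rEq₁ w w')      = ⟨ ε , lv w ▷ w' ⟩ ∷ [] ⨾ [] ⊢ []
principal (rEq₂ w w')      = ⟨ ε , w' ▷ lv w ⟩ ∷ [] ⨾ [] ⊢ []
principal (rP x y z w)     = ⟨ x , y ▷ z ⟩ ∷ ⟨ x , y ▷ lv w ⟩ ∷ [] ⨾ [] ⊢ []
principal (rC x y z w)     = ⟨ x , y ▷ z ⟩ ∷ ⟨ x , lv w ▷ z ⟩ ∷ [] ⨾ [] ⊢ []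

trigger : Rule → Items
trigger r = items (principal r)

Natural : Subst → List Label → (Label → Label → Items) → (Label → Label → Items) → Set
Natural σ ps f g = ∀ {x y} a b → lv x ∉ ps → lv y ∉ ps → x ≢ y →
                   apply (extend₂ x y a b σ) (f (lv x) (lv y)) ≡ g a b

Renames : List Label → (Label → Label → Items) → Set
Renames ps f = Natural ids ps f f

-- `none`: no rule has this form. The list ps of `eigen` holds the labels of the principal items.
data Shape : Set where
  none axiom : Shape
  one        : Items → Shape
  two        : Items → Items → Shape
  eigen      : (ps : List Label) (f : Label → Label → Items) → Renames ps f → Shape
  identify   : ℕ → Label → Items → Shape

✶L-premise : Label → Formula → Formula → Label → Label → Items
✶L-premise w A B a b = rel ⟨ a , b ▷ w ⟩ ∷ left (a ∶ A) ∷ left (b ∶ B) ∷ []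

-✶R-premise : Label → Formula → Formula → Label → Label → Items
-✶R-premise w A B a b = rel ⟨ a , w ▷ b ⟩ ∷ left (a ∶ A) ∷ right (b ∶ B) ∷ []

-- A and AC have a single eigenvariable; the second one is ignored.
A-premise : Label → Label → Label → Label → Label → Label → Items
A-premise y z u v a _ = rel ⟨ u , a ▷ z ⟩ ∷ rel ⟨ y , v ▷ a ⟩ ∷ []

AC-premise : Label → Label → Label → Label → Items
AC-premise x y a _ = rel ⟨ x , a ▷ x ⟩ ∷ rel ⟨ y , y ▷ a ⟩ ∷ []

✶L-natural : ∀ σ w {w'} A B → applyL σ w ≡ w' → Natural σ (w ∷ []) (✶L-premise w A B) (✶L-premise w' A B)
✶L-natural σ w A B refl {x} {y} a b x∉ y∉ x≢y
  rewrite extend₂-x x y a b σ | extend₂-y a b σ x≢y | extend₂-param a b σ x∉ y∉ (here refl) = refl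

-✶R-natural : ∀ σ w {w'} A B → applyL σ w ≡ w' → Natural σ (w ∷ []) (-✶R-premise w A B) (-✶R-premise w' A B)
-✶R-natural σ w A B refl {x} {y} a b x∉ y∉ x≢y
  rewrite extend₂-x x y a b σ | extend₂-y a b σ x≢y | extend₂-param a b σ x∉ y∉ (here refl) = refl

A-natural : ∀ σ x y z u v {y' z' u' v'} →
            applyL σ y ≡ y' → applyL σ z ≡ z' → applyL σ u ≡ u' → applyL σ v ≡ v' →
            Natural σ (x ∷ y ∷ z ∷ u ∷ v ∷ x ∷ []) (A-premise y z u v) (A-premise y' z' u' v')
A-natural σ x y z u v refl refl refl refl {x₀} {y₀} a b x∉ y∉ x≢y
  rewrite extend₂-x x₀ y₀ a b σ
        | extend₂-param {ℓ = y} a b σ x∉ y∉ (there (here refl))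
        | extend₂-param {ℓ = z} a b σ x∉ y∉ (there (there (here refl)))
        | extend₂-param {ℓ = u} a b σ x∉ y∉ (there (there (there (here refl))))
        | extend₂-param {ℓ = v} a b σ x∉ y∉ (there (there (there (there (here refl))))) = refl

AC-natural : ∀ σ x y {x' y'} → applyL σ x ≡ x' → applyL σ y ≡ y' →
             Natural σ (x ∷ y ∷ x ∷ []) (AC-premise x y) (AC-premise x' y')
AC-natural σ x y refl refl {x₀} {y₀} a b x∉ y∉ x≢y
  rewrite extend₂-x x₀ y₀ a b σ
        | extend₂-param {ℓ = x} a b σ x∉ y∉ (here refl)
        | extend₂-param {ℓ = y} a b σ x∉ y∉ (there (here refl)) = refl

leftShape : Label → Formula → Shape
leftShape w (pv _)   = none
leftShape w ⊤f       = none
leftShape w ⊥f       = axiom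
leftShape w (A ∧f B) = one (left (w ∶ A) ∷ left (w ∶ B) ∷ [])
leftShape w (A ⇒f B) = two (right (w ∶ A) ∷ []) (left (w ∶ B) ∷ [])
leftShape w ⊤*       = one (rel ⟨ ε , w ▷ ε ⟩ ∷ [])
leftShape w (A ✶ B)  = eigen (w ∷ []) (✶L-premise w A B) (✶L-natural ids w A B (applyL-ids w))
leftShape w (A -✶ B) = none

rightShape : Label → Formula → Shape
rightShape w      (pv _)   = none
rightShape w      ⊤f       = axiom
rightShape w      ⊥f       = none
rightShape w      (A ∧f B) = two (right (w ∶ A) ∷ []) (right (w ∶ B) ∷ [])
rightShape w      (A ⇒f B) = one (left (w ∶ A) ∷ right (w ∶ B) ∷ [])
rightShape ε      ⊤*       = axiom
rightShape (lv _) ⊤*       = none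
rightShape w      (A ✶ B)  = none
rightShape w      (A -✶ B) = eigen (w ∷ []) (-✶R-premise w A B) (-✶R-natural ids w A B (applyL-ids w))

shape : Rule → Shape
shape (rId _ _)        = axiom
shape (rL w A)         = leftShape w A
shape (rR w A)         = rightShape w A
shape (r✶R x y z A B)  = two (right (x ∶ A) ∷ []) (right (y ∶ B) ∷ [])
shape (r-✶L x y z A B) = two (right (x ∶ A) ∷ []) (left (z ∶ B) ∷ [])
shape (rE x y z)       = one (rel ⟨ y , x ▷ z ⟩ ∷ [])
shape (rA x y z u v)   = eigen (x ∷ y ∷ z ∷ u ∷ v ∷ x ∷ []) (A-premise y z u v)
                           (A-natural ids x y z u v (applyL-ids y) (applyL-ids z) (applyL-ids u) (applyL-ids v))
shape (rU x)           = one (rel ⟨ x , ε ▷ x ⟩ ∷ [])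
shape (rAC x y)        = eigen (x ∷ y ∷ x ∷ []) (AC-premise x y) (AC-natural ids x y (applyL-ids x) (applyL-ids y))
shape (rEq₁ w w')      = identify w w' []
shape (rEq₂ w w')      = identify w w' []
shape (rP x y z w)     = identify w z (rel ⟨ x , y ▷ z ⟩ ∷ [])
shape (rC x y z w)     = identify w y (rel ⟨ x , y ▷ z ⟩ ∷ [])

-- An instance r applies to S when its principal items `trigger r` belong to S; the premises extend S
-- (an `identify x a e` premise first substitutes a for the variable x), and `eigen` premises are
-- given for all pairs of distinct labels outside a finite list.
data Der : ℕ → Items → Set
data Prems (n : ℕ) (S : Items) : Shape → Set

data Der where
  rule : ∀ {n S} r {p} → shape r ≡ p → trigger r ⊆ S → Prems n S p → Der (suc n) S

data Prems n S where
  axiom    : Prems n S axiom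
  one      : ∀ {l} → Der n (l ++ S) → Prems n S (one l)
  two      : ∀ {l₁ l₂} → Der n (l₁ ++ S) → Der n (l₂ ++ S) → Prems n S (two l₁ l₂)
  eigen    : ∀ {ps f} {ok : Renames ps f} (L : List Label) →
             (∀ x y → lv x ∉ L → lv y ∉ L → x ≢ y → Der n (f (lv x) (lv y) ++ S)) → Prems n S (eigen ps f ok)
  identify : ∀ {x a e} → Der n (e ++ apply (x ≔ a) S) → Prems n S (identify x a e)

Provable : Items → Set
Provable S = Σ ℕ λ n → Der n S

Der-mono : ∀ {m n S} → m ≤ n → Der m S → Der n S
Der-mono {n = suc n} (s≤s m≤n) (rule r eq t ps) = rule r eq t (mono ps)
  where
  mono : ∀ {S p} → Prems _ S p → Prems n S p
  mono axiom          = axiom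
  mono (one d)        = one (Der-mono m≤n d)
  mono (two d e)      = two (Der-mono m≤n d) (Der-mono m≤n e)
  mono (eigen L g)    = eigen L λ x y x∉ y∉ x≢y → Der-mono m≤n (g x y x∉ y∉ x≢y)
  mono (identify d)   = identify (Der-mono m≤n d)

weaken : ∀ {n S T} → Der n S → S ⊆ T → Der n T
weaken {S = S} {T} (rule r eq t ps) S⊆T = rule r eq (⊆-trans t S⊆T) (weakenP ps)
  where
  weakenP : ∀ {n p} → Prems n S p → Prems n T p
  weakenP axiom                  = axiom
  weakenP (one {l} d)            = one (weaken d (++⁺ʳ l S⊆T))
  weakenP (two {l₁} {l₂} d e)    = two (weaken d (++⁺ʳ l₁ S⊆T)) (weaken e (++⁺ʳ l₂ S⊆T))
  weakenP (eigen {f = f} L g)    =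
    eigen L λ x y x∉ y∉ x≢y → weaken (g x y x∉ y∉ x≢y) (++⁺ʳ (f (lv x) (lv y)) S⊆T)
  weakenP (identify {x} {a} {e} d) = identify (weaken d (++⁺ʳ e (map⁺ (applyI (x ≔ a)) S⊆T)))

Der-subst : ∀ {n S} σ → Der n S → Der n (apply σ S)

eigen-renamed : ∀ {n S ps f g} σ → Natural σ ps f g → ∀ {x y} → lv x ∉ ps → lv y ∉ ps →
                lv x ∉ labels S → lv y ∉ labels S → x ≢ y →
                Der n (f (lv x) (lv y) ++ S) → ∀ a b → Der n (g a b ++ apply σ S)
eigen-renamed {S = S} {f = f} σ natural {x} {y} x∉ps y∉ps x∉S y∉S x≢y d a b =
  subst (Der _) renamed (Der-subst (extend₂ x y a b σ) d)
  where
  renamed : apply (extend₂ x y a b σ) (f (lv x) (lv y) ++ S) ≡ _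
  renamed = trans (apply-++ _ (f (lv x) (lv y)) S)
                  (cong₂ _++_ (natural a b x∉ps y∉ps x≢y) (apply-agree S (extend₂-agree a b σ x∉S y∉S)))

subst-eigen : ∀ {n S ps ps' f f'} {ok : Renames ps f} {ok' : Renames ps' f'} σ → Natural σ ps f f' →
              Prems n S (eigen ps f ok) → Prems n (apply σ S) (eigen ps' f' ok')
subst-eigen {S = S} {ps} {f = f} {f'} σ natural (eigen L g) =
  eigen [] λ a b _ _ _ → eigen-renamed {f = f} {f'} σ natural x₀∉₂ y₀∉₂ x₀∉₃ y₀∉₃ x₀≢y₀
                                       (g x₀ y₀ x₀∉₁ y₀∉₁ x₀≢y₀) (lv a) (lv b)
  where open Fresh₂ (fresh₂ L ps (labels S))

subst-identified : ∀ {n S x a e} σ → e ⊆ S → Der n (e ++ apply (x ≔ a) S) →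
                   Der n (apply (unifier (σ x) (applyL σ a)) (apply σ S))
subst-identified {S = S} {x} {a} {e} σ e⊆S d =
  subst (Der _) (sym (apply-≫ σ θ S))
        (weaken (subst (Der _) premise (Der-subst (σ ≫ θ) d)) (++-⊆ (map⁺ _ e⊆S) ⊆-refl))
  where
  θ = unifier (σ x) (applyL σ a)
  premise : apply (σ ≫ θ) (e ++ apply (x ≔ a) S) ≡ apply (σ ≫ θ) e ++ apply (σ ≫ θ) S
  premise = trans (apply-++ (σ ≫ θ) e _)
                  (cong (apply (σ ≫ θ) e ++_)
                        (apply-≔-unifier (σ ≫ θ) S
                                         (trans (sym (applyL-≫ σ θ a)) (unifier-unifies (σ x) (applyL σ a)))))

Eq₁-unified : ∀ {n T} a b → rel ⟨ ε , a ▷ b ⟩ ∈ T → Der n (apply (unifier a b) T) → Der (suc n) T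
Eq₁-unified (lv k) b      p d = rule (rEq₁ k b) refl (⊆-singleton p) (identify d)
Eq₁-unified ε      (lv k) p d = rule (rEq₂ k ε) refl (⊆-singleton p) (identify d)
Eq₁-unified {T = T} ε ε   p d = Der-mono (n≤1+n _) (subst (Der _) (apply-ids T) d)

Eq₂-unified : ∀ {n T} a b → rel ⟨ ε , b ▷ a ⟩ ∈ T → Der n (apply (unifier a b) T) → Der (suc n) T
Eq₂-unified (lv k) b      p d = rule (rEq₂ k b) refl (⊆-singleton p) (identify d)
Eq₂-unified ε      (lv k) p d = rule (rEq₁ k ε) refl (⊆-singleton p) (identify d)
Eq₂-unified {T = T} ε ε   p d = Der-mono (n≤1+n _) (subst (Der _) (apply-ids T) d)

P-unified : ∀ {n T} x y a b → rel ⟨ x , y ▷ b ⟩ ∈ T → rel ⟨ x , y ▷ a ⟩ ∈ T →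
            Der n (apply (unifier a b) T) → Der (suc n) T
P-unified x y (lv k) b      p q d = rule (rP x y b k) refl (⊆-pair p q) (identify (weaken d (xs⊆ys++xs _ _)))
P-unified x y ε      (lv k) p q d = rule (rP x y ε k) refl (⊆-pair q p) (identify (weaken d (xs⊆ys++xs _ _)))
P-unified {T = T} x y ε ε   p q d = Der-mono (n≤1+n _) (subst (Der _) (apply-ids T) d)

C-unified : ∀ {n T} x z a b → rel ⟨ x , b ▷ z ⟩ ∈ T → rel ⟨ x , a ▷ z ⟩ ∈ T →
            Der n (apply (unifier a b) T) → Der (suc n) T
C-unified x z (lv k) b      p q d = rule (rC x b z k) refl (⊆-pair p q) (identify (weaken d (xs⊆ys++xs _ _)))
C-unified x z ε      (lv k) p q d = rule (rC x ε z k) refl (⊆-pair q p) (identify (weaken d (xs⊆ys++xs _ _)))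
C-unified {T = T} x z ε ε   p q d = Der-mono (n≤1+n _) (subst (Der _) (apply-ids T) d)

subst-left : ∀ {n S} σ w A → Prems n S (leftShape w A) → Prems n (apply σ S) (leftShape (applyL σ w) A)
subst-left σ w ⊥f       axiom     = axiom
subst-left σ w (A ∧f B) (one d)   = one (Der-subst σ d)
subst-left σ w (A ⇒f B) (two d e) = two (Der-subst σ d) (Der-subst σ e)
subst-left σ w ⊤*       (one d)   = one (Der-subst σ d)
subst-left σ w (A ✶ B)  ps        = subst-eigen σ (✶L-natural σ w A B refl) ps

subst-right : ∀ {n S} σ w A → Prems n S (rightShape w A) → Prems n (apply σ S) (rightShape (applyL σ w) A)
subst-right σ w      ⊤f       axiom     = axiom
subst-right σ w      (A ∧f B) (two d e) = two (Der-subst σ d) (Der-subst σ e)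
subst-right σ w      (A ⇒f B) (one d)   = one (Der-subst σ d)
subst-right σ ε      ⊤*       axiom     = axiom
subst-right σ w      (A -✶ B) ps        = subst-eigen σ (-✶R-natural σ w A B refl) ps

Der-subst σ (rule (rId w p) refl t axiom) = rule (rId (applyL σ w) p) refl (map⁺ _ t) axiom
Der-subst σ (rule (rL w A) refl t ps) = rule (rL (applyL σ w) A) refl (map⁺ _ t) (subst-left σ w A ps)
Der-subst σ (rule (rR w A) refl t ps) = rule (rR (applyL σ w) A) refl (map⁺ _ t) (subst-right σ w A ps)
Der-subst σ (rule (r✶R x y z A B) refl t (two d e)) =
  rule (r✶R (applyL σ x) (applyL σ y) (applyL σ z) A B) refl (map⁺ _ t) (two (Der-subst σ d) (Der-subst σ e))
Der-subst σ (rule (r-✶L x y z A B) refl t (two d e)) =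
  rule (r-✶L (applyL σ x) (applyL σ y) (applyL σ z) A B) refl (map⁺ _ t) (two (Der-subst σ d) (Der-subst σ e))
Der-subst σ (rule (rE x y z) refl t (one d)) =
  rule (rE (applyL σ x) (applyL σ y) (applyL σ z)) refl (map⁺ _ t) (one (Der-subst σ d))
Der-subst σ (rule (rA x y z u v) refl t ps) =
  rule (rA (applyL σ x) (applyL σ y) (applyL σ z) (applyL σ u) (applyL σ v)) refl (map⁺ _ t)
       (subst-eigen σ (A-natural σ x y z u v refl refl refl refl) ps)
Der-subst σ (rule (rU x) refl t (one d)) = rule (rU (applyL σ x)) refl (map⁺ _ t) (one (Der-subst σ d))
Der-subst σ (rule (rAC x y) refl t ps) =
  rule (rAC (applyL σ x) (applyL σ y)) refl (map⁺ _ t) (subst-eigen σ (AC-natural σ x y refl refl) ps)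
Der-subst σ (rule (rEq₁ w w') refl t (identify d)) =
  Eq₁-unified (σ w) (applyL σ w') (∈-map⁺ _ (t (here refl))) (subst-identified σ (λ ()) d)
Der-subst σ (rule (rEq₂ w w') refl t (identify d)) =
  Eq₂-unified (σ w) (applyL σ w') (∈-map⁺ _ (t (here refl))) (subst-identified σ (λ ()) d)
Der-subst σ (rule (rP x y z w) refl t (identify d)) =
  P-unified (applyL σ x) (applyL σ y) (σ w) (applyL σ z) (∈-map⁺ _ (t (here refl))) (∈-map⁺ _ (t (there (here refl))))
            (subst-identified σ (⊆-singleton (t (here refl))) d)
Der-subst σ (rule (rC x y z w) refl t (identify d)) =
  C-unified (applyL σ x) (applyL σ z) (σ w) (applyL σ y) (∈-map⁺ _ (t (here refl))) (∈-map⁺ _ (t (there (here refl))))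
            (subst-identified σ (⊆-singleton (t (here refl))) d)

rename-eigen : ∀ {n S ps f} → Renames ps f → ∀ {x y} → lv x ∉ ps → lv y ∉ ps →
               lv x ∉ labels S → lv y ∉ labels S → x ≢ y →
               Der n (f (lv x) (lv y) ++ S) → ∀ a b → Der n (f a b ++ S)
rename-eigen {S = S} {f = f} ok x∉ps y∉ps x∉S y∉S x≢y d a b =
  subst (λ T → Der _ (_ ++ T)) (apply-ids S) (eigen-renamed {f = f} {f} ids ok x∉ps y∉ps x∉S y∉S x≢y d a b)

eigen-instance : ∀ {n S ps f} (ok : Renames ps f) {x y} → lv x ∉ ps → lv y ∉ ps →
                 lv x ∉ labels S → lv y ∉ labels S → x ≢ y →
                 Der n (f (lv x) (lv y) ++ S) → Prems n S (eigen ps f ok)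
eigen-instance ok x∉ps y∉ps x∉S y∉S x≢y d =
  eigen [] λ a b _ _ _ → rename-eigen ok x∉ps y∉ps x∉S y∉S x≢y d (lv a) (lv b)

data Prems∃ (T : Items) : Shape → Set where
  axiom    : Prems∃ T axiom
  one      : ∀ {l} → Provable (l ++ T) → Prems∃ T (one l)
  two      : ∀ {l₁ l₂} → Provable (l₁ ++ T) → Provable (l₂ ++ T) → Prems∃ T (two l₁ l₂)
  eigen    : ∀ {ps f} {ok : Renames ps f} x y → lv x ∉ ps → lv y ∉ ps → lv x ∉ labels T → lv y ∉ labels T →
             x ≢ y → Provable (f (lv x) (lv y) ++ T) → Prems∃ T (eigen ps f ok)
  identify : ∀ {x a e} → Provable (e ++ apply (x ≔ a) T) → Prems∃ T (identify x a e)

assemble : ∀ {T} r {p} → shape r ≡ p → trigger r ⊆ T → Prems∃ T p → Provable T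
assemble r eq t axiom                 = 1 , rule r eq t axiom
assemble r eq t (one (k , d))         = suc k , rule r eq t (one d)
assemble r eq t (two (k , d) (l , e)) =
  suc (k ⊔ l) , rule r eq t (two (Der-mono (m≤m⊔n k l) d) (Der-mono (m≤n⊔m k l) e))
assemble r {eigen _ _ ok} eq t (eigen x y x∉ps y∉ps x∉T y∉T x≢y (k , d)) =
  suc k , rule r eq t (eigen-instance ok x∉ps y∉ps x∉T y∉T x≢y d)
assemble r eq t (identify (k , d))    = suc k , rule r eq t (identify d)

weaken∃ : ∀ {S T} → Provable S → S ⊆ T → Provable T
weaken∃ (k , d) S⊆T = k , weaken d S⊆T

data LeftPrincipal : Rule → LFormula → Set where
  by-rL   : ∀ w A → LeftPrincipal (rL w A) (w ∶ A)
  by-rId  : ∀ w p → LeftPrincipal (rId w p) (w ∶ pv p)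
  by-r-✶L : ∀ x y z A B → LeftPrincipal (r-✶L x y z A B) (y ∶ A -✶ B)

left-principal : ∀ r {f} → left f ∈ trigger r → LeftPrincipal r f
left-principal r p = view r (∈-items⁻ (principal r) p)
  where
  view : ∀ r {f} → left f ∈ₛ principal r → LeftPrincipal r f
  view (rL w A)         (here refl) = by-rL w A
  view (rId w p)        (here refl) = by-rId w p
  view (r-✶L x y z A B) (here refl) = by-r-✶L x y z A B

data RightPrincipal : Rule → LFormula → Set where
  by-rR  : ∀ w A → RightPrincipal (rR w A) (w ∶ A)
  by-rId : ∀ w p → RightPrincipal (rId w p) (w ∶ pv p)
  by-r✶R : ∀ x y z A B → RightPrincipal (r✶R x y z A B) (z ∶ A ✶ B)

right-principal : ∀ r {f} → right f ∈ trigger r → RightPrincipal r f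
right-principal r p = view r (∈-items⁻ (principal r) p)
  where
  view : ∀ r {f} → right f ∈ₛ principal r → RightPrincipal r f
  view (rR w A)         (here refl) = by-rR w A
  view (rId w p)        (here refl) = by-rId w p
  view (r✶R x y z A B)  (here refl) = by-r✶R x y z A B

data Branch : Item → Set where
  ∧L      : ∀ {w A B} → Branch (left (w ∶ A ∧f B))
  ⇒L₁ ⇒L₂ : ∀ {w A B} → Branch (left (w ∶ A ⇒f B))
  ⊤*L     : ∀ {w} → Branch (left (w ∶ ⊤*))
  ✶L      : ∀ {w A B} → Label → Label → Branch (left (w ∶ A ✶ B))
  ∧R₁ ∧R₂ : ∀ {w A B} → Branch (right (w ∶ A ∧f B))
  ⇒R      : ∀ {w A B} → Branch (right (w ∶ A ⇒f B))
  -✶R     : ∀ {w A B} → Label → Label → Branch (right (w ∶ A -✶ B))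

branch : ∀ {φ} → Branch φ → Items
branch (∧L {w} {A} {B})      = left (w ∶ A) ∷ left (w ∶ B) ∷ []
branch (⇒L₁ {w} {A})         = right (w ∶ A) ∷ []
branch (⇒L₂ {w} {B = B})     = left (w ∶ B) ∷ []
branch (⊤*L {w})             = rel ⟨ ε , w ▷ ε ⟩ ∷ []
branch (✶L {w} {A} {B} a b)  = ✶L-premise w A B a b
branch (∧R₁ {w} {A})         = right (w ∶ A) ∷ []
branch (∧R₂ {w} {B = B})     = right (w ∶ B) ∷ []
branch (⇒R {w} {A} {B})      = left (w ∶ A) ∷ right (w ∶ B) ∷ []
branch (-✶R {w} {A} {B} a b) = -✶R-premise w A B a b

branch-apply : ∀ σ {φ} → Branch φ → Branch (applyI σ φ)
branch-apply σ ∧L        = ∧L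
branch-apply σ ⇒L₁       = ⇒L₁
branch-apply σ ⇒L₂       = ⇒L₂
branch-apply σ ⊤*L       = ⊤*L
branch-apply σ (✶L a b)  = ✶L (applyL σ a) (applyL σ b)
branch-apply σ ∧R₁       = ∧R₁
branch-apply σ ∧R₂       = ∧R₂
branch-apply σ ⇒R        = ⇒R
branch-apply σ (-✶R a b) = -✶R (applyL σ a) (applyL σ b)

branch-branch-apply : ∀ σ {φ} (c : Branch φ) → branch (branch-apply σ c) ≡ apply σ (branch c)
branch-branch-apply σ ∧L        = refl
branch-branch-apply σ ⇒L₁       = refl
branch-branch-apply σ ⇒L₂       = refl
branch-branch-apply σ ⊤*L       = refl
branch-branch-apply σ (✶L a b)  = refl
branch-branch-apply σ ∧R₁       = refl
branch-branch-apply σ ∧R₂       = refl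
branch-branch-apply σ ⇒R        = refl
branch-branch-apply σ (-✶R a b) = refl

invert : ∀ {n S T φ} (c : Branch φ) → Der n S → S ⊆ φ ∷ T → Der n (branch c ++ T)

invert-prems : ∀ {n S T φ p} (c : Branch φ) → Prems n S p → S ⊆ φ ∷ T → Prems n (branch c ++ T) p
invert-prems {n} {S} {T} c ps cov = go ps
  where
  inverted : ∀ l → Der n (l ++ S) → Der n (l ++ branch c ++ T)
  inverted l d = weaken (invert c d (cover-++ l cov)) (shift-⊆ (branch c) l)
  go : ∀ {p} → Prems n S p → Prems n (branch c ++ T) p
  go axiom                = axiom
  go (one {l} d)          = one (inverted l d)
  go (two {l₁} {l₂} d e)  = two (inverted l₁ d) (inverted l₂ e)
  go (eigen {f = f} L g)  = eigen L λ x y x∉ y∉ x≢y → inverted (f (lv x) (lv y)) (g x y x∉ y∉ x≢y)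
  go (identify {x} {a} {e} d) =
    identify (weaken (invert (branch-apply (x ≔ a) c) d (cover-++ e (map⁺ _ cov))) incl)
    where
    incl : branch (branch-apply (x ≔ a) c) ++ e ++ apply (x ≔ a) T ⊆ e ++ apply (x ≔ a) (branch c ++ T)
    incl = begin
      branch (branch-apply (x ≔ a) c) ++ e ++ apply (x ≔ a) T ≡⟨ cong (_++ _) (branch-branch-apply (x ≔ a) c) ⟩
      apply (x ≔ a) (branch c) ++ e ++ apply (x ≔ a) T       ⊆⟨ shift-⊆ (apply (x ≔ a) (branch c)) e ⟩
      e ++ apply (x ≔ a) (branch c) ++ apply (x ≔ a) T       ≡⟨ cong (e ++_) (apply-++ (x ≔ a) (branch c) T) ⟨
      e ++ apply (x ≔ a) (branch c ++ T)                      ∎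
      where open ⊆-Reasoning Item

invert-premise : ∀ {n S T φ} (c : Branch φ) → Der n (branch c ++ S) → S ⊆ φ ∷ T → Der n (branch c ++ T)
invert-premise c d cov = weaken (invert c d (cover-++ (branch c) cov)) (++-dup (branch c))

invert-premise-suc : ∀ {n S T φ} (c : Branch φ) → Der n (branch c ++ S) → S ⊆ φ ∷ T → Der (suc n) (branch c ++ T)
invert-premise-suc c d cov = Der-mono (n≤1+n _) (invert-premise c d cov)

invert-left : ∀ {n S T w A p} (c : Branch (left (w ∶ A))) → leftShape w A ≡ p → Prems n S p →
              S ⊆ left (w ∶ A) ∷ T → Der (suc n) (branch c ++ T)
invert-left c@∧L  refl (one d)   cov = invert-premise-suc c d cov
invert-left c@⇒L₁ refl (two d _) cov = invert-premise-suc c d cov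
invert-left c@⇒L₂ refl (two _ d) cov = invert-premise-suc c d cov
invert-left c@⊤*L refl (one d)   cov = invert-premise-suc c d cov
invert-left {S = S} {T} {w} (✶L {A = A} {B} a b) refl (eigen L g) cov =
  Der-mono (n≤1+n _)
           (rename-eigen (✶L-natural ids w A B (applyL-ids w)) x₀∉₂ y₀∉₂ x₀∉₃ y₀∉₃ x₀≢y₀ d a b)
  where
  open Fresh₂ (fresh₂ L (w ∷ []) (labels T))
  d : Der _ (✶L-premise w A B (lv x₀) (lv y₀) ++ T)
  d = invert-premise (✶L (lv x₀) (lv y₀)) (g x₀ y₀ x₀∉₁ y₀∉₁ x₀≢y₀) cov

invert-right : ∀ {n S T w A p} (c : Branch (right (w ∶ A))) → rightShape w A ≡ p → Prems n S p →
               S ⊆ right (w ∶ A) ∷ T → Der (suc n) (branch c ++ T)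
invert-right c@∧R₁ refl (two d _) cov = invert-premise-suc c d cov
invert-right c@∧R₂ refl (two _ d) cov = invert-premise-suc c d cov
invert-right c@⇒R  refl (one d)   cov = invert-premise-suc c d cov
invert-right {S = S} {T} {w} (-✶R {A = A} {B} a b) refl (eigen L g) cov =
  Der-mono (n≤1+n _)
           (rename-eigen (-✶R-natural ids w A B (applyL-ids w)) x₀∉₂ y₀∉₂ x₀∉₃ y₀∉₃ x₀≢y₀ d a b)
  where
  open Fresh₂ (fresh₂ L (w ∷ []) (labels T))
  d : Der _ (-✶R-premise w A B (lv x₀) (lv y₀) ++ T)
  d = invert-premise (-✶R (lv x₀) (lv y₀)) (g x₀ y₀ x₀∉₁ y₀∉₁ x₀≢y₀) cov

invert-principal : ∀ {n S T φ p} (c : Branch φ) r → shape r ≡ p → φ ∈ trigger r → Prems n S p →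
                   S ⊆ φ ∷ T → Der (suc n) (branch c ++ T)
invert-principal {φ = left _} c r eq φ∈ ps cov with left-principal r φ∈
... | by-rL w A = invert-left c eq ps cov
invert-principal {φ = right _} c r eq φ∈ ps cov with right-principal r φ∈
... | by-rR w A = invert-right c eq ps cov

invert c (rule r eq t ps) cov with ⊆∷⇒∈∨⊆ (⊆-trans t cov)
... | inj₁ φ∈ = invert-principal c r eq φ∈ ps cov
... | inj₂ t' = rule r eq (⊆-trans t' (xs⊆ys++xs _ (branch c))) (invert-prems c ps cov)

-- What a derivation of T plus a ∶ A on the right, with a ∶ A principal, yields for a cut on a ∶ A.
RightPremises : Formula → Label → Items → Set
RightPremises (pv _)   a T = ⊥
RightPremises ⊤f       a T = ⊤
RightPremises ⊥f       a T = ⊥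
RightPremises (A ∧f B) a T = Provable (right (a ∶ A) ∷ T) × Provable (right (a ∶ B) ∷ T)
RightPremises (A ⇒f B) a T = Provable (left (a ∶ A) ∷ right (a ∶ B) ∷ T)
RightPremises ⊤*       a T = a ≡ ε
RightPremises (A ✶ B)  a T = Σ Label λ x → Σ Label λ y →
  rel ⟨ x , y ▷ a ⟩ ∈ T × Provable (right (x ∶ A) ∷ T) × Provable (right (y ∶ B) ∷ T)
RightPremises (A -✶ B) a T = Σ (List Label) λ L → ∀ x y → lv x ∉ L → lv y ∉ L → x ≢ y →
  Provable (-✶R-premise a A B (lv x) (lv y) ++ T)

weaken-right-premises : ∀ A {a T T'} → RightPremises A a T → T ⊆ T' → RightPremises A a T'
weaken-right-premises ⊤f       tt              T⊆T' = tt
weaken-right-premises (A ∧f B) (dA , dB)       T⊆T' = weaken∃ dA (∷⁺ʳ _ T⊆T') , weaken∃ dB (∷⁺ʳ _ T⊆T')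
weaken-right-premises (A ⇒f B) d               T⊆T' = weaken∃ d (∷⁺ʳ _ (∷⁺ʳ _ T⊆T'))
weaken-right-premises ⊤*       a≡ε             T⊆T' = a≡ε
weaken-right-premises (A ✶ B)  (x , y , p , dA , dB) T⊆T' =
  x , y , T⊆T' p , weaken∃ dA (∷⁺ʳ _ T⊆T') , weaken∃ dB (∷⁺ʳ _ T⊆T')
weaken-right-premises (A -✶ B) (L , g)         T⊆T' =
  L , λ x y x∉ y∉ x≢y → weaken∃ (g x y x∉ y∉ x≢y) (++⁺ʳ _ T⊆T')

subst-right-premises : ∀ A σ {a T} → RightPremises A a T → RightPremises A (applyL σ a) (apply σ T)
subst-right-premises ⊤f       σ tt        = tt
subst-right-premises (A ∧f B) σ ((k , dA) , (l , dB)) = (k , Der-subst σ dA) , (l , Der-subst σ dB)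
subst-right-premises (A ⇒f B) σ (k , d)   = k , Der-subst σ d
subst-right-premises ⊤*       σ refl      = refl
subst-right-premises (A ✶ B)  σ (x , y , p , (k , dA) , (l , dB)) =
  applyL σ x , applyL σ y , ∈-map⁺ _ p , (k , Der-subst σ dA) , (l , Der-subst σ dB)
subst-right-premises (A -✶ B) σ {a} {T} (L , g) = [] , renamed
  where
  open Fresh₂ (fresh₂ L (a ∷ []) (labels T))
  renamed : ∀ x y → lv x ∉ [] → lv y ∉ [] → x ≢ y →
            Provable (-✶R-premise (applyL σ a) A B (lv x) (lv y) ++ apply σ T)
  renamed x y _ _ _ with g x₀ y₀ x₀∉₁ y₀∉₁ x₀≢y₀
  ... | k , d = k , eigen-renamed {f = -✶R-premise a A B} σ (-✶R-natural σ a A B refl)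
                                  x₀∉₂ y₀∉₂ x₀∉₃ y₀∉₃ x₀≢y₀ d (lv x) (lv y)

Cut : Formula → Set
Cut A = ∀ {n m a S₁ S₂ T} → Der n S₁ → Der m S₂ →
        S₁ ⊆ right (a ∶ A) ∷ T → S₂ ⊆ left (a ∶ A) ∷ T → Provable T

CutBelow : Formula → Set
CutBelow (A ∧f B) = Cut A × Cut B
CutBelow (A ⇒f B) = Cut A × Cut B
CutBelow (A ✶ B)  = Cut A × Cut B
CutBelow (A -✶ B) = Cut A × Cut B
CutBelow _        = ⊤

cut∃ : ∀ {A a S₁ S₂ T} → Cut A → Provable S₁ → Provable S₂ →
       S₁ ⊆ right (a ∶ A) ∷ T → S₂ ⊆ left (a ∶ A) ∷ T → Provable T
cut∃ c (_ , d₁) (_ , d₂) = c d₁ d₂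

cut-left : ∀ A → CutBelow A → Cut A

cut-left-prems : ∀ A → CutBelow A → ∀ {n m a S₁ S₂ T p} → Prems n S₁ p → Der m S₂ →
                 S₁ ⊆ right (a ∶ A) ∷ T → S₂ ⊆ left (a ∶ A) ∷ T → Prems∃ T p

cut-left-principal : ∀ A → CutBelow A → ∀ {n m a S₁ S₂ T} r {p} → shape r ≡ p → trigger r ⊆ S₁ →
                     RightPrincipal r (a ∶ A) → Prems n S₁ p → Der m S₂ →
                     S₁ ⊆ right (a ∶ A) ∷ T → S₂ ⊆ left (a ∶ A) ∷ T → Provable T

cut-left-rR : ∀ A → CutBelow A → ∀ {n m w S₁ S₂ T} → Prems n S₁ (rightShape w A) → Der m S₂ →
              S₁ ⊆ right (w ∶ A) ∷ T → S₂ ⊆ left (w ∶ A) ∷ T → RightPremises A w T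

cut-right : ∀ A → CutBelow A → ∀ {m a S₂ T} → RightPremises A a T → Der m S₂ →
            S₂ ⊆ left (a ∶ A) ∷ T → Provable T

cut-right-prems : ∀ A → CutBelow A → ∀ {m a S₂ T p} → RightPremises A a T → Prems m S₂ p →
                  S₂ ⊆ left (a ∶ A) ∷ T → Prems∃ T p

cut-right-principal : ∀ A → CutBelow A → ∀ {m a S₂ T} r {p} → shape r ≡ p → trigger r ⊆ S₂ →
                      LeftPrincipal r (a ∶ A) → RightPremises A a T → Prems m S₂ p →
                      S₂ ⊆ left (a ∶ A) ∷ T → Provable T

cut-right-rL : ∀ A → CutBelow A → ∀ {m w S₂ T} → RightPremises A w T → Prems m S₂ (leftShape w A) →
               S₂ ⊆ left (w ∶ A) ∷ T → Provable T

cut-left A below (rule r eq t ps) d₂ cov₁ cov₂ with ⊆∷⇒∈∨⊆ (⊆-trans t cov₁)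
... | inj₁ φ∈ = cut-left-principal A below r eq t (right-principal r φ∈) ps d₂ cov₁ cov₂
... | inj₂ t' = assemble r eq t' (cut-left-prems A below ps d₂ cov₁ cov₂)

cut-left-prems A below axiom d₂ cov₁ cov₂ = axiom
cut-left-prems A below (one {l} d) d₂ cov₁ cov₂ = one (cut-left A below d d₂ (cover-++ l cov₁) (weaken-cover l cov₂))
cut-left-prems A below (two {l₁} {l₂} d e) d₂ cov₁ cov₂ =
  two (cut-left A below d d₂ (cover-++ l₁ cov₁) (weaken-cover l₁ cov₂))
      (cut-left A below e d₂ (cover-++ l₂ cov₁) (weaken-cover l₂ cov₂))
cut-left-prems A below {T = T} (eigen {ps} {f} L g) d₂ cov₁ cov₂ =
  eigen x₀ y₀ x₀∉₂ y₀∉₂ x₀∉₃ y₀∉₃ x₀≢y₀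
        (cut-left A below (g x₀ y₀ x₀∉₁ y₀∉₁ x₀≢y₀) d₂ (cover-++ l cov₁) (weaken-cover l cov₂))
  where
  open Fresh₂ (fresh₂ L ps (labels T))
  l = f (lv x₀) (lv y₀)
cut-left-prems A below (identify {x} {a} {e} d) d₂ cov₁ cov₂ =
  identify (cut-left A below d (Der-subst (x ≔ a) d₂) (cover-++ e (map⁺ _ cov₁)) (weaken-cover e (map⁺ _ cov₂)))

cut-left-principal A below (rR w A) refl t (by-rR w A) ps d₂ cov₁ cov₂ =
  cut-right A below (cut-left-rR A below ps d₂ cov₁ cov₂) d₂ cov₂
cut-left-principal (pv p) below (rId w p) refl t (by-rId w p) axiom d₂ cov₁ cov₂ =
  _ , weaken d₂ (⊆-trans cov₂ (∷-absorb (∈-∷-≢ (cov₁ (t (here refl))) λ ())))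
cut-left-principal (A ✶ B) below (r✶R x y z A B) refl t (by-r✶R x y z A B) (two d e) d₂ cov₁ cov₂ =
  cut-right (A ✶ B) below
            (x , y , ∈-∷-≢ (cov₁ (t (here refl))) (λ ())
               , cut-left (A ✶ B) below d d₂ (cover-++ _ cov₁) (weaken-cover _ cov₂)
               , cut-left (A ✶ B) below e d₂ (cover-++ _ cov₁) (weaken-cover _ cov₂))
            d₂ cov₂

cut-left-rR ⊤f       below          axiom     d₂ cov₁ cov₂ = tt
cut-left-rR (A ∧f B) below          (two d e) d₂ cov₁ cov₂ =
  cut-left (A ∧f B) below d d₂ (cover-++ _ cov₁) (weaken-cover _ cov₂) ,
  cut-left (A ∧f B) below e d₂ (cover-++ _ cov₁) (weaken-cover _ cov₂)
cut-left-rR (A ⇒f B) below          (one d)   d₂ cov₁ cov₂ =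
  cut-left (A ⇒f B) below d d₂ (cover-++ _ cov₁) (weaken-cover _ cov₂)
cut-left-rR ⊤* below {w = ε}        axiom     d₂ cov₁ cov₂ = refl
cut-left-rR (A -✶ B) below          (eigen L g) d₂ cov₁ cov₂ =
  L , λ x y x∉ y∉ x≢y →
        cut-left (A -✶ B) below (g x y x∉ y∉ x≢y) d₂ (cover-++ _ cov₁) (weaken-cover _ cov₂)

cut-right A below info (rule r eq t ps) cov₂ with ⊆∷⇒∈∨⊆ (⊆-trans t cov₂)
... | inj₁ φ∈ = cut-right-principal A below r eq t (left-principal r φ∈) info ps cov₂
... | inj₂ t' = assemble r eq t' (cut-right-prems A below info ps cov₂)

cut-right-prems A below info axiom cov₂ = axiom
cut-right-prems A below {T = T} info (one {l} d) cov₂ =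
  one (cut-right A below (weaken-right-premises A info (xs⊆ys++xs T l)) d (cover-++ l cov₂))
cut-right-prems A below {T = T} info (two {l₁} {l₂} d e) cov₂ =
  two (cut-right A below (weaken-right-premises A info (xs⊆ys++xs T l₁)) d (cover-++ l₁ cov₂))
      (cut-right A below (weaken-right-premises A info (xs⊆ys++xs T l₂)) e (cover-++ l₂ cov₂))
cut-right-prems A below {T = T} info (eigen {ps} {f} L g) cov₂ =
  eigen x₀ y₀ x₀∉₂ y₀∉₂ x₀∉₃ y₀∉₃ x₀≢y₀
        (cut-right A below (weaken-right-premises A info (xs⊆ys++xs T l))
                   (g x₀ y₀ x₀∉₁ y₀∉₁ x₀≢y₀) (cover-++ l cov₂))
  where
  open Fresh₂ (fresh₂ L ps (labels T))
  l = f (lv x₀) (lv y₀)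
cut-right-prems A below {T = T} info (identify {x} {a} {e} d) cov₂ =
  identify (cut-right A below (weaken-right-premises A (subst-right-premises A (x ≔ a) info) (xs⊆ys++xs _ e))
                      d (cover-++ e (map⁺ _ cov₂)))

cut-right-principal A below (rL w A) refl t (by-rL w A) info ps cov₂ = cut-right-rL A below info ps cov₂
cut-right-principal (A -✶ B) below@(cutA , cutB) {S₂ = S₂} {T} (r-✶L x y z A B) refl t (by-r-✶L x y z A B)
                    info@(L , g) (two d₁ d₂) cov₂ =
  cut∃ cutB (cut∃ cutA (premise d₁) (weaken∃ instantiated (∷-absorb (there (there xyz∈T)))) cover-tail ⊆-refl)
       (premise d₂) ⊆-refl ⊆-refl
  where
  open Fresh₂ (fresh₂ L (y ∷ []) (labels T))
  xyz∈T = ∈-∷-≢ (cov₂ (t (here refl))) λ ()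
  premise : ∀ {n f} → Der n (f ∷ S₂) → Provable (f ∷ T)
  premise d = cut-right (A -✶ B) below (weaken-right-premises (A -✶ B) info (xs⊆x∷xs T _)) d (cover-++ _ cov₂)
  instantiated : Provable (-✶R-premise y A B x z ++ T)
  instantiated = _ , rename-eigen (-✶R-natural ids y A B (applyL-ids y)) x₀∉₂ y₀∉₂ x₀∉₃ y₀∉₃ x₀≢y₀
                                  (proj₂ (g x₀ y₀ x₀∉₁ y₀∉₁ x₀≢y₀)) x z

cut-right-rL (A ∧f B) below@(cutA , cutB) {w = w} {T = T} info@(dA , dB) (one d) cov₂ =
  cut∃ cutB dB (cut∃ cutA dA premise cover-tail ⊆-refl) ⊆-refl ⊆-refl
  where
  premise : Provable (left (w ∶ A) ∷ left (w ∶ B) ∷ T)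
  premise = cut-right (A ∧f B) below (weaken-right-premises (A ∧f B) info (xs⊆ys++xs T _)) d (cover-++ _ cov₂)
cut-right-rL (A ⇒f B) below@(cutA , cutB) {S₂ = S₂} {T = T} info (two d₁ d₂) cov₂ =
  cut∃ cutB (cut∃ cutA (premise d₁) info cover-tail ⊆-refl) (premise d₂) ⊆-refl ⊆-refl
  where
  premise : ∀ {n f} → Der n (f ∷ S₂) → Provable (f ∷ T)
  premise d = cut-right (A ⇒f B) below (weaken-right-premises (A ⇒f B) info (xs⊆x∷xs T _)) d (cover-++ _ cov₂)
cut-right-rL ⊤* below refl (one d) cov₂ = assemble (rU ε) refl []⊆ (one (cut-right ⊤* below refl d (cover-++ _ cov₂)))
cut-right-rL (A ✶ B) below@(cutA , cutB) {w = w} {T = T} info@(x , y , xyw∈T , dA , dB) (eigen L g) cov₂ =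
  cut∃ cutB dB (cut∃ cutA dA (weaken∃ instantiated (∷-absorb (there (there xyw∈T)))) cover-tail ⊆-refl)
       ⊆-refl ⊆-refl
  where
  open Fresh₂ (fresh₂ L (w ∷ []) (labels T))
  premise : Provable (✶L-premise w A B (lv x₀) (lv y₀) ++ T)
  premise = cut-right (A ✶ B) below (weaken-right-premises (A ✶ B) info (xs⊆ys++xs T _))
                      (g x₀ y₀ x₀∉₁ y₀∉₁ x₀≢y₀) (cover-++ _ cov₂)
  instantiated : Provable (✶L-premise w A B x y ++ T)
  instantiated = _ , rename-eigen (✶L-natural ids w A B (applyL-ids w)) x₀∉₂ y₀∉₂ x₀∉₃ y₀∉₃ x₀≢y₀
                                  (proj₂ premise) x y

cut-below : ∀ A → CutBelow A
cut : ∀ A → Cut A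
cut A = cut-left A (cut-below A)
cut-below (pv _)   = tt
cut-below ⊤f       = tt
cut-below ⊥f       = tt
cut-below (A ∧f B) = cut A , cut B
cut-below (A ⇒f B) = cut A , cut B
cut-below ⊤*       = tt
cut-below (A ✶ B)  = cut A , cut B
cut-below (A -✶ B) = cut A , cut B

ante-tail : ∀ {G Γ Δ f} → (G ⨾ Γ ⊢ Δ) ⊑ (G ⨾ f ∷ Γ ⊢ Δ)
ante-tail {Γ = Γ} {f = f} = ⊆-refl , xs⊆x∷xs Γ f , ⊆-refl

succ-tail : ∀ {G Γ Δ f} → (G ⨾ Γ ⊢ Δ) ⊑ (G ⨾ Γ ⊢ f ∷ Δ)
succ-tail {Δ = Δ} {f = f} = ⊆-refl , ⊆-refl , xs⊆x∷xs Δ f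

peel : ∀ new s {s'} → s ⊑ s' → items (new ⊕ s) ⊆ items new ++ items s'
peel new s s⊑s' = ⊆-trans (items-⊕⁻ new s) (++⁺ʳ (items new) (items-mono s⊑s'))

fresh-items : ∀ {x} s → Fresh x s → lv x ∉ labels (items s)
fresh-items s x∉ p = x∉ (subst (_ ∈_) (labels-items s) p)

items-fresh : ∀ {x} s → lv x ∉ labels (items s) → Fresh x s
items-fresh s x∉ p = x∉ (subst (_ ∈_) (sym (labels-items s)) p)

eigen-fresh : ∀ s {ps f} {ok : Renames ps f} {x y} → ps ⊆ labels (items s) → Fresh x s → Fresh y s → x ≢ y →
              Provable (f (lv x) (lv y) ++ items s) → Prems∃ (items s) (eigen ps f ok)
eigen-fresh s ps⊆ fx fy x≢y d =
  eigen _ _ (fresh-items s fx ∘ ps⊆) (fresh-items s fy ∘ ps⊆) (fresh-items s fx) (fresh-items s fy) x≢y d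

eigen-fresh₁ : ∀ s {ps f} {ok : Renames ps f} {x} → ps ⊆ labels (items s) → Fresh x s →
               (∀ b → Provable (f (lv x) b ++ items s)) → Prems∃ (items s) (eigen ps f ok)
eigen-fresh₁ s {x = x} ps⊆ fx d = eigen-fresh s ps⊆ fx fy x≢y (d (lv y))
  where
  L = lv x ∷ labels (items s)
  y = fresh L
  fy : Fresh y s
  fy = items-fresh s λ p → fresh-∉ L (there p)
  x≢y : x ≢ y
  x≢y e = fresh-∉ L (here (cong lv (sym e)))

≈S⇒⊑ : ∀ {s s'} → s ≈S s' → s ⊑ s'
≈S⇒⊑ {G ⨾ Γ ⊢ Δ} {G' ⨾ Γ' ⊢ Δ'} (G⊆ , _ , Γ↭ , Δ↭) = G⊆ , ⊆-reflexive-↭ Γ↭ , ⊆-reflexive-↭ Δ↭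

principal⊆ : ∀ r s → principal r ⊑ s → trigger r ⊆ items s
principal⊆ r s = items-mono {principal r} {s}

embed : ∀ {s} → Derivable s → Provable (items s)
embed (reorder {s} {s'} s≈s' d) = weaken∃ (embed d) (items-mono {s} {s'} (≈S⇒⊑ s≈s'))
embed {s} (id-rule {w = w} {p}) = assemble (rId w p) refl (principal⊆ (rId w p) s ([]⊆ , head⊆ , head⊆)) axiom
embed (cut-rule {G} {G'} {Γ} {Γ'} {Δ} {Δ'} {x} {A} _ d e) =
  cut A (proj₂ (embed d)) (proj₂ (embed e))
      (peel ([] ⨾ [] ⊢ x ∶ A ∷ []) (G ⨾ Γ ⊢ Δ) (xs⊆xs++ys G G' , xs⊆xs++ys Γ Γ' , xs⊆xs++ys Δ Δ'))
      (peel ([] ⨾ x ∶ A ∷ [] ⊢ []) (G' ⨾ Γ' ⊢ Δ') (xs⊆ys++xs G' G , xs⊆ys++xs Γ' Γ , xs⊆ys++xs Δ' Δ))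
embed {s} (⊥L {w = w})  = assemble (rL w ⊥f) refl (principal⊆ (rL w ⊥f) s ([]⊆ , head⊆ , []⊆)) axiom
embed {s} (⊤R {w = w})  = assemble (rR w ⊤f) refl (principal⊆ (rR w ⊤f) s ([]⊆ , []⊆ , head⊆)) axiom
embed {s} ⊤*R = assemble (rR ε ⊤*) refl (principal⊆ (rR ε ⊤*) s ([]⊆ , []⊆ , head⊆)) axiom
embed {s} (⊤*L {G} {Γ} {Δ} {w} d) =
  assemble (rL w ⊤*) refl (principal⊆ (rL w ⊤*) s ([]⊆ , head⊆ , []⊆))
           (one (weaken∃ (embed d) (peel (⟨ ε , w ▷ ε ⟩ ∷ [] ⨾ [] ⊢ []) (G ⨾ Γ ⊢ Δ) ante-tail)))
embed {s} (∧L {G} {Γ} {Δ} {w} {A} {B} d) =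
  assemble (rL w (A ∧f B)) refl (principal⊆ (rL w (A ∧f B)) s ([]⊆ , head⊆ , []⊆))
           (one (weaken∃ (embed d) (peel ([] ⨾ w ∶ A ∷ w ∶ B ∷ [] ⊢ []) (G ⨾ Γ ⊢ Δ) ante-tail)))
embed {s} (∧R {G} {Γ} {Δ} {w} {A} {B} d e) =
  assemble (rR w (A ∧f B)) refl (principal⊆ (rR w (A ∧f B)) s ([]⊆ , []⊆ , head⊆))
           (two (weaken∃ (embed d) (peel ([] ⨾ [] ⊢ w ∶ A ∷ []) (G ⨾ Γ ⊢ Δ) succ-tail))
                (weaken∃ (embed e) (peel ([] ⨾ [] ⊢ w ∶ B ∷ []) (G ⨾ Γ ⊢ Δ) succ-tail)))
embed {s} (⇒L {G} {Γ} {Δ} {w} {A} {B} d e) =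
  assemble (rL w (A ⇒f B)) refl (principal⊆ (rL w (A ⇒f B)) s ([]⊆ , head⊆ , []⊆))
           (two (weaken∃ (embed d) (peel ([] ⨾ [] ⊢ w ∶ A ∷ []) (G ⨾ Γ ⊢ Δ) ante-tail))
                (weaken∃ (embed e) (peel ([] ⨾ w ∶ B ∷ [] ⊢ []) (G ⨾ Γ ⊢ Δ) ante-tail)))
embed {s} (⇒R {G} {Γ} {Δ} {w} {A} {B} d) =
  assemble (rR w (A ⇒f B)) refl (principal⊆ (rR w (A ⇒f B)) s ([]⊆ , []⊆ , head⊆))
           (one (weaken∃ (embed d) (peel ([] ⨾ w ∶ A ∷ [] ⊢ w ∶ B ∷ []) (G ⨾ Γ ⊢ Δ) succ-tail)))
embed {s} (✶L {G} {Γ} {Δ} {x} {y} {z} {A} {B} fx fy x≢y d) =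
  assemble (rL z (A ✶ B)) refl t
           (eigen-fresh s (labels-mono t) fx fy x≢y
                        (weaken∃ (embed d) (peel (⟨ lv x , lv y ▷ z ⟩ ∷ [] ⨾ lv x ∶ A ∷ lv y ∶ B ∷ [] ⊢ [])
                                                 (G ⨾ Γ ⊢ Δ) ante-tail)))
  where t = principal⊆ (rL z (A ✶ B)) s ([]⊆ , head⊆ , []⊆)
embed {s} (-✶R {G} {Γ} {Δ} {x} {y} {z} {A} {B} fx fy x≢y d) =
  assemble (rR z (A -✶ B)) refl t
           (eigen-fresh s (labels-mono t) fx fy x≢y
                        (weaken∃ (embed d) (peel (⟨ lv x , z ▷ lv y ⟩ ∷ [] ⨾ lv x ∶ A ∷ [] ⊢ lv y ∶ B ∷ [])
                                                 (G ⨾ Γ ⊢ Δ) succ-tail)))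
  where t = principal⊆ (rR z (A -✶ B)) s ([]⊆ , []⊆ , head⊆)
embed {s} (✶R {x = x} {y} {z} {A} {B} d e) =
  assemble (r✶R x y z A B) refl (principal⊆ (r✶R x y z A B) s (head⊆ , []⊆ , head⊆))
           (two (weaken∃ (embed d) (items-⊕⁻ ([] ⨾ [] ⊢ x ∶ A ∷ []) s))
                (weaken∃ (embed e) (items-⊕⁻ ([] ⨾ [] ⊢ y ∶ B ∷ []) s)))
embed {s} (-✶L {G} {Γ} {Δ} {x} {y} {z} {A} {B} d e) =
  assemble (r-✶L x y z A B) refl (principal⊆ (r-✶L x y z A B) s (head⊆ , head⊆ , []⊆))
           (two (weaken∃ (embed d) (items-⊕⁻ ([] ⨾ [] ⊢ x ∶ A ∷ []) s))
                (weaken∃ (embed e) premise⊆))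
  where
  premise⊆ : items (⟨ x , y ▷ z ⟩ ∷ G ⨾ y ∶ A -✶ B ∷ z ∶ B ∷ Γ ⊢ Δ) ⊆ left (z ∶ B) ∷ items s
  premise⊆ = ⊆-trans (items-mono {s' = ([] ⨾ z ∶ B ∷ [] ⊢ []) ⊕ s}
                                 (⊆-refl , ⊆-reflexive-↭ (swap _ _ ↭-refl) , ⊆-refl))
                     (items-⊕⁻ ([] ⨾ z ∶ B ∷ [] ⊢ []) s)
embed {s} (E-rule {x = x} {y} {z} d) =
  assemble (rE x y z) refl (principal⊆ (rE x y z) s (head⊆ , []⊆ , []⊆)) (one (embed d))
embed {s} (A-rule {G} {Γ} {Δ} {x} {y} {z} {u} {v} fw d) =
  assemble (rA x y z u v) refl t (eigen-fresh₁ s (labels-mono t) fw λ _ → embed d)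
  where t = principal⊆ (rA x y z u v) s (⊆-pair (here refl) (there (here refl)) , []⊆ , []⊆)
embed {s} (U-rule {x = x} d) = assemble (rU x) refl []⊆ (one (embed d))
embed {s} (AC {G} {Γ} {Δ} {x} {y} fw d) =
  assemble (rAC x y) refl t (eigen-fresh₁ s (labels-mono t) fw λ _ → embed d)
  where t = principal⊆ (rAC x y) s (head⊆ , []⊆ , []⊆)
embed {s} (Eq₁ {G} {Γ} {Δ} {w} {w'} d) =
  assemble (rEq₁ w w') refl (principal⊆ (rEq₁ w w') s (head⊆ , []⊆ , []⊆)) (identify (weaken∃ (embed d) premise⊆))
  where
  premise⊆ : rel ⟨ ε , w' ▷ w' ⟩ ∷ items (substG w' w G ⨾ substΓ w' w Γ ⊢ substΓ w' w Δ)
             ⊆ apply (w ≔ w') (items (⟨ ε , lv w ▷ w' ⟩ ∷ G ⨾ Γ ⊢ Δ))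
  premise⊆ rewrite items-substitute w' w G Γ Δ | extend-here w w' ids | ≔-idem w w' = ⊆-refl
embed {s} (Eq₂ {G} {Γ} {Δ} {w} {w'} d) =
  assemble (rEq₂ w w') refl (principal⊆ (rEq₂ w w') s (head⊆ , []⊆ , []⊆)) (identify (weaken∃ (embed d) premise⊆))
  where
  premise⊆ : rel ⟨ ε , w' ▷ w' ⟩ ∷ items (substG w' w G ⨾ substΓ w' w Γ ⊢ substΓ w' w Δ)
             ⊆ apply (w ≔ w') (items (⟨ ε , w' ▷ lv w ⟩ ∷ G ⨾ Γ ⊢ Δ))
  premise⊆ rewrite items-substitute w' w G Γ Δ | extend-here w w' ids | ≔-idem w w' = ⊆-refl
embed {s} (P-rule {G} {Γ} {Δ} {x} {y} {z} {w} d) =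
  assemble (rP x y z w) refl (principal⊆ (rP x y z w) s (⊆-pair (here refl) (there (here refl)) , []⊆ , []⊆))
           (identify (weaken∃ (embed d) premise⊆))
  where
  premise⊆ : rel ⟨ x , y ▷ z ⟩ ∷ items (substG z w G ⨾ substΓ z w Γ ⊢ substΓ z w Δ)
             ⊆ rel ⟨ x , y ▷ z ⟩ ∷ apply (w ≔ z) (items (⟨ x , y ▷ z ⟩ ∷ ⟨ x , y ▷ lv w ⟩ ∷ G ⨾ Γ ⊢ Δ))
  premise⊆ rewrite items-substitute z w G Γ Δ = ∷⁺ʳ _ (xs⊆ys++xs _ (_ ∷ _ ∷ []))
embed {s} (C-rule {G} {Γ} {Δ} {x} {y} {z} {w} d) =
  assemble (rC x y z w) refl (principal⊆ (rC x y z w) s (⊆-pair (here refl) (there (here refl)) , []⊆ , []⊆))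
           (identify (weaken∃ (embed d) premise⊆))
  where
  premise⊆ : rel ⟨ x , y ▷ z ⟩ ∷ items (substG y w G ⨾ substΓ y w Γ ⊢ substΓ y w Δ)
             ⊆ rel ⟨ x , y ▷ z ⟩ ∷ apply (w ≔ y) (items (⟨ x , y ▷ z ⟩ ∷ ⟨ x , lv w ▷ z ⟩ ∷ G ⨾ Γ ⊢ Δ))
  premise⊆ rewrite items-substitute y w G Γ Δ = ∷⁺ʳ _ (xs⊆ys++xs _ (_ ∷ _ ∷ []))

with-ante : ∀ {G Γ Γ₀ Δ f} → Γ ↭ f ∷ Γ₀ →
            CutFreeDerivable (G ⨾ f ∷ Γ₀ ⊢ Δ) → CutFreeDerivable (G ⨾ Γ ⊢ Δ)
with-ante Γ↭ = reorder (⊆-refl , ⊆-refl , ↭-sym Γ↭ , ↭-refl)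

with-succ : ∀ {G Γ Δ Δ₀ f} → Δ ↭ f ∷ Δ₀ →
            CutFreeDerivable (G ⨾ Γ ⊢ f ∷ Δ₀) → CutFreeDerivable (G ⨾ Γ ⊢ Δ)
with-succ Δ↭ = reorder (⊆-refl , ⊆-refl , ↭-refl , ↭-sym Δ↭)

with-rel : ∀ {G Γ Δ r} → r ∈ G → CutFreeDerivable (r ∷ G ⨾ Γ ⊢ Δ) → CutFreeDerivable (G ⨾ Γ ⊢ Δ)
with-rel {G} {r = r} r∈G = reorder (∷-absorb r∈G , xs⊆x∷xs G r , ↭-refl , ↭-refl)

with-rels : ∀ {G Γ Δ r r'} → r ∈ G → r' ∈ G →
            CutFreeDerivable (r ∷ r' ∷ G ⨾ Γ ⊢ Δ) → CutFreeDerivable (G ⨾ Γ ⊢ Δ)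
with-rels {G} {r = r} {r'} r∈G r'∈G =
  reorder (∷-absorb r∈G ∘ ∷⁺ʳ r (∷-absorb r'∈G) , there ∘ xs⊆x∷xs G r' , ↭-refl , ↭-refl)

remove-ante : ∀ {G Γ Γ₀ Δ f} → Γ ↭ f ∷ Γ₀ → items (G ⨾ Γ ⊢ Δ) ⊆ left f ∷ items (G ⨾ Γ₀ ⊢ Δ)
remove-ante {G} {Γ} {Γ₀} {Δ} {f} Γ↭ =
  ⊆-trans (items-mono {G ⨾ Γ ⊢ Δ} {G ⨾ f ∷ Γ₀ ⊢ Δ} (⊆-refl , ⊆-reflexive-↭ Γ↭ , ⊆-refl))
          (items-⊕⁻ ([] ⨾ f ∷ [] ⊢ []) (G ⨾ Γ₀ ⊢ Δ))

remove-succ : ∀ {G Γ Δ Δ₀ f} → Δ ↭ f ∷ Δ₀ → items (G ⨾ Γ ⊢ Δ) ⊆ right f ∷ items (G ⨾ Γ ⊢ Δ₀)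
remove-succ {G} {Γ} {Δ} {Δ₀} {f} Δ↭ =
  ⊆-trans (items-mono {G ⨾ Γ ⊢ Δ} {G ⨾ Γ ⊢ f ∷ Δ₀} (⊆-refl , ⊆-refl , ⊆-reflexive-↭ Δ↭))
          (items-⊕⁻ ([] ⨾ [] ⊢ f ∷ []) (G ⨾ Γ ⊢ Δ₀))

-- By induction on the height, as inverted premises are not structurally smaller.
extract : ∀ n s → Der n (items s) → CutFreeDerivable s

extract-premise : ∀ n new s → Der n (items new ++ items s) → CutFreeDerivable (new ⊕ s)
extract-premise n new s d = extract n (new ⊕ s) (weaken d (items-⊕⁺ new s))

extract-left : ∀ n {S G Γ₀ Δ} w A → S ⊆ left (w ∶ A) ∷ items (G ⨾ Γ₀ ⊢ Δ) → Prems n S (leftShape w A) →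
               CutFreeDerivable (G ⨾ w ∶ A ∷ Γ₀ ⊢ Δ)
extract-left n w ⊥f       cov axiom = ⊥L
extract-left n {G = G} {Γ₀} {Δ} w (A ∧f B) cov (one d) =
  ∧L (extract-premise n ([] ⨾ w ∶ A ∷ w ∶ B ∷ [] ⊢ []) (G ⨾ Γ₀ ⊢ Δ) (invert-premise ∧L d cov))
extract-left n {G = G} {Γ₀} {Δ} w (A ⇒f B) cov (two d e) =
  ⇒L (extract-premise n ([] ⨾ [] ⊢ w ∶ A ∷ []) (G ⨾ Γ₀ ⊢ Δ) (invert-premise ⇒L₁ d cov))
     (extract-premise n ([] ⨾ w ∶ B ∷ [] ⊢ []) (G ⨾ Γ₀ ⊢ Δ) (invert-premise ⇒L₂ e cov))
extract-left n {G = G} {Γ₀} {Δ} w ⊤* cov (one d) =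
  ⊤*L (extract-premise n (⟨ ε , w ▷ ε ⟩ ∷ [] ⨾ [] ⊢ []) (G ⨾ Γ₀ ⊢ Δ) (invert-premise ⊤*L d cov))
extract-left n {G = G} {Γ₀} {Δ} w (A ✶ B) cov (eigen L g) =
  ✶L (items-fresh s x₀∉₂) (items-fresh s y₀∉₂) x₀≢y₀
     (extract-premise n (⟨ lv x₀ , lv y₀ ▷ w ⟩ ∷ [] ⨾ lv x₀ ∶ A ∷ lv y₀ ∶ B ∷ [] ⊢ []) (G ⨾ Γ₀ ⊢ Δ)
                      (invert-premise (✶L (lv x₀) (lv y₀)) (g x₀ y₀ x₀∉₁ y₀∉₁ x₀≢y₀) cov))
  where
  s = G ⨾ w ∶ A ✶ B ∷ Γ₀ ⊢ Δ
  open Fresh₂ (fresh₂ L (labels (items s)) [])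

extract-right : ∀ n {S G Γ Δ₀} w A → S ⊆ right (w ∶ A) ∷ items (G ⨾ Γ ⊢ Δ₀) → Prems n S (rightShape w A) →
                CutFreeDerivable (G ⨾ Γ ⊢ w ∶ A ∷ Δ₀)
extract-right n w ⊤f cov axiom = ⊤R
extract-right n ε ⊤* cov axiom = ⊤*R
extract-right n {G = G} {Γ} {Δ₀} w (A ∧f B) cov (two d e) =
  ∧R (extract-premise n ([] ⨾ [] ⊢ w ∶ A ∷ []) (G ⨾ Γ ⊢ Δ₀) (invert-premise ∧R₁ d cov))
     (extract-premise n ([] ⨾ [] ⊢ w ∶ B ∷ []) (G ⨾ Γ ⊢ Δ₀) (invert-premise ∧R₂ e cov))
extract-right n {G = G} {Γ} {Δ₀} w (A ⇒f B) cov (one d) =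
  ⇒R (extract-premise n ([] ⨾ w ∶ A ∷ [] ⊢ w ∶ B ∷ []) (G ⨾ Γ ⊢ Δ₀) (invert-premise ⇒R d cov))
extract-right n {G = G} {Γ} {Δ₀} w (A -✶ B) cov (eigen L g) =
  -✶R (items-fresh s x₀∉₂) (items-fresh s y₀∉₂) x₀≢y₀
      (extract-premise n (⟨ lv x₀ , w ▷ lv y₀ ⟩ ∷ [] ⨾ lv x₀ ∶ A ∷ [] ⊢ lv y₀ ∶ B ∷ []) (G ⨾ Γ ⊢ Δ₀)
                       (invert-premise (-✶R (lv x₀) (lv y₀)) (g x₀ y₀ x₀∉₁ y₀∉₁ x₀≢y₀) cov))
  where
  s = G ⨾ Γ ⊢ w ∶ A -✶ B ∷ Δ₀
  open Fresh₂ (fresh₂ L (labels (items s)) [])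

extract (suc n) s@(G ⨾ Γ ⊢ Δ) (rule (rId w p) refl t axiom)
  with pick (∈-items⁻ s (t (here refl))) | pick (∈-items⁻ s (t (there (here refl))))
... | _ , Γ↭ | _ , Δ↭ = with-ante Γ↭ (with-succ Δ↭ id-rule)
extract (suc n) s@(G ⨾ Γ ⊢ Δ) (rule (rL w A) refl t ps) with pick (∈-items⁻ s (t (here refl)))
... | _ , Γ↭ = with-ante Γ↭ (extract-left n w A (remove-ante {G} {Δ = Δ} Γ↭) ps)
extract (suc n) s@(G ⨾ Γ ⊢ Δ) (rule (rR w A) refl t ps) with pick (∈-items⁻ s (t (here refl)))
... | _ , Δ↭ = with-succ Δ↭ (extract-right n w A (remove-succ {G} {Γ} Δ↭) ps)
extract (suc n) s@(G ⨾ Γ ⊢ Δ) (rule (r✶R x y z A B) refl t (two d e)) with pick (∈-items⁻ s (t (there (here refl))))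
... | Δ₀ , Δ↭ =
  with-rel (∈-items⁻ s (t (here refl)))
    (with-succ Δ↭ (✶R (extract-premise n ([] ⨾ [] ⊢ x ∶ A ∷ []) s₁ (weaken d (∷⁺ʳ _ s⊆s₁)))
                      (extract-premise n ([] ⨾ [] ⊢ y ∶ B ∷ []) s₁ (weaken e (∷⁺ʳ _ s⊆s₁)))))
  where
  s₁ = ⟨ x , y ▷ z ⟩ ∷ G ⨾ Γ ⊢ z ∶ A ✶ B ∷ Δ₀
  s⊆s₁ : items s ⊆ items s₁
  s⊆s₁ = items-mono {s} {s₁} (xs⊆x∷xs G _ , ⊆-refl , ⊆-reflexive-↭ Δ↭)
extract (suc n) s@(G ⨾ Γ ⊢ Δ) (rule (r-✶L x y z A B) refl t (two d e)) with pick (∈-items⁻ s (t (there (here refl))))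
... | Γ₀ , Γ↭ =
  with-rel (∈-items⁻ s (t (here refl)))
    (with-ante Γ↭ (-✶L (extract-premise n ([] ⨾ [] ⊢ x ∶ A ∷ []) s₁ (weaken d (∷⁺ʳ _ s⊆s₁)))
                       (extract n _ (weaken e premise⊆))))
  where
  s₁ = ⟨ x , y ▷ z ⟩ ∷ G ⨾ y ∶ A -✶ B ∷ Γ₀ ⊢ Δ
  s⊆s₁ : items s ⊆ items s₁
  s⊆s₁ = items-mono {s} {s₁} (xs⊆x∷xs G _ , ⊆-reflexive-↭ Γ↭ , ⊆-refl)
  premise⊆ : left (z ∶ B) ∷ items s ⊆ items (⟨ x , y ▷ z ⟩ ∷ G ⨾ y ∶ A -✶ B ∷ z ∶ B ∷ Γ₀ ⊢ Δ)
  premise⊆ = ⊆-trans (∷⁺ʳ _ s⊆s₁)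
             (⊆-trans (items-⊕⁺ ([] ⨾ z ∶ B ∷ [] ⊢ []) s₁)
                      (items-mono {([] ⨾ z ∶ B ∷ [] ⊢ []) ⊕ s₁} {⟨ x , y ▷ z ⟩ ∷ G ⨾ y ∶ A -✶ B ∷ z ∶ B ∷ Γ₀ ⊢ Δ}
                                  (⊆-refl , ⊆-reflexive-↭ (swap _ _ ↭-refl) , ⊆-refl)))
extract (suc n) s@(G ⨾ Γ ⊢ Δ) (rule (rE x y z) refl t (one d)) =
  with-rel (∈-items⁻ s (t (here refl))) (E-rule (extract n _ (weaken d (∷⁺ʳ _ (xs⊆x∷xs _ _)))))
extract (suc n) s@(G ⨾ Γ ⊢ Δ) (rule (rA x y z u v) refl t (eigen L g)) =
  with-rels xyz∈G uvx∈G (A-rule (items-fresh s₁ λ p → x₀∉₂ (labels-mono s₁⊆s p))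
                                (extract n _ (weaken (g x₀ y₀ x₀∉₁ y₀∉₁ x₀≢y₀)
                                                     (∷⁺ʳ _ (∷⁺ʳ _ (xs⊆ys++xs _ (_ ∷ _ ∷ [])))))))
  where
  open Fresh₂ (fresh₂ L (labels (items s)) [])
  xyz∈G = ∈-items⁻ s (t (here refl))
  uvx∈G = ∈-items⁻ s (t (there (here refl)))
  s₁ = ⟨ x , y ▷ z ⟩ ∷ ⟨ u , v ▷ x ⟩ ∷ G ⨾ Γ ⊢ Δ
  s₁⊆s : items s₁ ⊆ items s
  s₁⊆s = ++-⊆ (⊆-pair (t (here refl)) (t (there (here refl)))) ⊆-refl
extract (suc n) s@(G ⨾ Γ ⊢ Δ) (rule (rU x) refl t (one d)) = U-rule (extract n _ d)
extract (suc n) s@(G ⨾ Γ ⊢ Δ) (rule (rAC x y) refl t (eigen L g)) =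
  with-rel (∈-items⁻ s (t (here refl)))
    (AC (items-fresh s₁ λ p → x₀∉₂ (labels-mono s₁⊆s p))
        (extract n _ (weaken (g x₀ y₀ x₀∉₁ y₀∉₁ x₀≢y₀) (∷⁺ʳ _ (∷⁺ʳ _ (xs⊆x∷xs _ _))))))
  where
  open Fresh₂ (fresh₂ L (labels (items s)) [])
  s₁ = ⟨ x , y ▷ x ⟩ ∷ G ⨾ Γ ⊢ Δ
  s₁⊆s : items s₁ ⊆ items s
  s₁⊆s = ∷-absorb (t (here refl))
extract (suc n) s@(G ⨾ Γ ⊢ Δ) (rule (rEq₁ w w') refl t (identify d)) =
  with-rel (∈-items⁻ s (t (here refl)))
    (Eq₁ (extract n _ (weaken d (xs⊆x∷xs _ _ ∘ ⊆-reflexive (sym (items-substitute w' w G Γ Δ))))))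
extract (suc n) s@(G ⨾ Γ ⊢ Δ) (rule (rEq₂ w w') refl t (identify d)) =
  with-rel (∈-items⁻ s (t (here refl)))
    (Eq₂ (extract n _ (weaken d (xs⊆x∷xs _ _ ∘ ⊆-reflexive (sym (items-substitute w' w G Γ Δ))))))
extract (suc n) s@(G ⨾ Γ ⊢ Δ) (rule (rP x y z w) refl t (identify d)) =
  with-rels (∈-items⁻ s (t (here refl))) (∈-items⁻ s (t (there (here refl))))
    (P-rule (extract n _ (subst (λ S → Der n (rel ⟨ x , y ▷ z ⟩ ∷ S)) (sym (items-substitute z w G Γ Δ)) d)))
extract (suc n) s@(G ⨾ Γ ⊢ Δ) (rule (rC x y z w) refl t (identify d)) =
  with-rels (∈-items⁻ s (t (here refl))) (∈-items⁻ s (t (there (here refl))))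
    (C-rule (extract n _ (subst (λ S → Der n (rel ⟨ x , y ▷ z ⟩ ∷ S)) (sym (items-substitute y w G Γ Δ)) d)))

mainTheorem2 : (s : Sequent) → Derivable s → CutFreeDerivable s
mainTheorem2 s d = extract _ s (proj₂ (embed d))
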